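{- Let $\ell_n=|L_n|$ and let $\Xi_C$ be the partition function of the polymer model described in the context. Then $$2^{\ell_n}\,\Xi_C=\alpha(L_{[n-1,n+1]}),$$ the number of antichains of $[3]^n$ contained in $L_{n-1}\cup L_n\cup L_{n+1}$.
   Context: $[3]^n=\{0,1,2\}^n$ with coordinatewise order; $L_k=\{v:\sum_iv_i=k\}$. The Hasse diagram joins $x,y$ if one covers the other; a set is 2-linked if it is connected in the graph where vertices at Hasse distance at most 2 are adjacent. Polymers: all nonempty 2-linked sets $A$ with $A\subseteq L_{n-1}$ or $A\subseteq L_{n+1}$. For a polymer $A$, $\partial(A)$ is the set of elements of $L_n$ comparable to at least one element of $A$, and $w_C(A)=2^{ -|\partial(A)|}$. Polymers $A_1,A_2$ are compatible iff $\partial(A_1)\cap\partial(A_2)=\emptyset$. The partition function is $\Xi_C=\sum_{\Lambda}\prod_{A\in\Lambda}w_C(A)$, the sum over all sets $\Lambda$ of pairwise compatible polymers (including $\Lambda=\emptyset$, contributing $1$). -}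

module Defs where

open import Data.Nat as ℕ using (ℕ; zero; suc; _+_; _≡ᵇ_)
open import Data.Fin as Fin using (Fin; toℕ)
open import Data.Fin.Properties as FinP using ()
open import Data.Vec as Vec using (Vec; []; _∷_)
open import Data.Vec.Properties using (≡-dec)
open import Data.Vec.Relation.Binary.Pointwise.Inductive as PW using (Pointwise)
open import Data.List as List using (List; []; _∷_; _++_; filter; length; map; concatMap)
open import Data.List.Relation.Unary.All as All using (All; all?)
open import Data.List.Relation.Unary.Any as Any using (Any; any?)
open import Data.List.Relation.Unary.AllPairs using (AllPairs; allPairs?)
open import Data.Product using (_×_; _,_)
open import Data.Sum using (_⊎_)
open import Data.Rational as ℚ using (ℚ; 0ℚ; 1ℚ; ½)
open import Relation.Binary.PropositionalEquality using (_≡_)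
open import Relation.Nullary using (¬_; Dec; _×-dec_; _⊎-dec_; ¬?)
import Data.List.Membership.DecPropositional as DecMem
import Data.Nat.Properties as ℕP

Pt : ℕ → Set
Pt n = Vec (Fin 3) n

_≟ᵖ_ : ∀ {n} (x y : Pt n) → Dec (x ≡ y)
_≟ᵖ_ = ≡-dec FinP._≟_

points : (n : ℕ) → List (Pt n)
points zero    = [] ∷ []
points (suc n) = concatMap (λ i → map (i ∷_) (points n)) (List.allFin 3)

module _ {n : ℕ} where
  open DecMem (_≟ᵖ_ {n}) public using (_∈?_)

_≼_ : ∀ {n} → Pt n → Pt n → Set
_≼_ = Pointwise Fin._≤_

_≼?_ : ∀ {n} (x y : Pt n) → Dec (x ≼ y)
_≼?_ = PW.decidable FinP._≤?_

_≺_ : ∀ {n} → Pt n → Pt n → Set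
x ≺ y = x ≼ y × ¬ (x ≡ y)

_≺?_ : ∀ {n} (x y : Pt n) → Dec (x ≺ y)
x ≺? y = (x ≼? y) ×-dec ¬? (x ≟ᵖ y)

Comparable : ∀ {n} → Pt n → Pt n → Set
Comparable x y = x ≼ y ⊎ y ≼ x

comparable? : ∀ {n} (x y : Pt n) → Dec (Comparable x y)
comparable? x y = (x ≼? y) ⊎-dec (y ≼? x)

Covers : ∀ {n} → Pt n → Pt n → Set
Covers {n} y x = x ≺ y × All (λ z → ¬ (x ≺ z × z ≺ y)) (points n)

covers? : ∀ {n} (y x : Pt n) → Dec (Covers y x)
covers? {n} y x = (x ≺? y) ×-dec all? (λ z → ¬? ((x ≺? z) ×-dec (z ≺? y))) (points n)

HasseAdj : ∀ {n} → Pt n → Pt n → Set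
HasseAdj x y = Covers x y ⊎ Covers y x

hasseAdj? : ∀ {n} (x y : Pt n) → Dec (HasseAdj x y)
hasseAdj? x y = covers? x y ⊎-dec covers? y x

Dist≤2 : ∀ {n} → Pt n → Pt n → Set
Dist≤2 {n} x y = x ≡ y ⊎ HasseAdj x y ⊎ Any (λ z → HasseAdj x z × HasseAdj z y) (points n)

dist≤2? : ∀ {n} (x y : Pt n) → Dec (Dist≤2 x y)
dist≤2? {n} x y = (x ≟ᵖ y) ⊎-dec (hasseAdj? x y ⊎-dec any? (λ z → hasseAdj? x z ×-dec hasseAdj? z y) (points n))

rank : ∀ {n} → Pt n → ℕ
rank v = Vec.sum (Vec.map toℕ v)

-- L_n, L_{n-1} (elements of rank r with r + 1 = n) and L_{n+1};
-- L_{n-1} is written so that it is empty for n = 0 (no truncated subtraction)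
levelN : (n : ℕ) → List (Pt n)
levelN n = filter (λ v → rank v ℕ.≟ n) (points n)

levelN-1 : (n : ℕ) → List (Pt n)
levelN-1 n = filter (λ v → suc (rank v) ℕ.≟ n) (points n)

levelN+1 : (n : ℕ) → List (Pt n)
levelN+1 n = filter (λ v → rank v ℕ.≟ suc n) (points n)

ℓ : ℕ → ℕ
ℓ n = length (levelN n)

-- Finite sets as sublists of a duplicate-free list

-- all sublists (= all subsets, when the input list has no duplicates)
subsets : ∀ {a} {A : Set a} → List A → List (List A)
subsets []       = [] ∷ []
subsets (x ∷ xs) = let s = subsets xs in s ++ map (x ∷_) s

-- 2-linked sets: connected in the graph on [3]^n where vertices at Hasse
-- distance ≤ 2 are adjacent.
-- reach A x k = elements of A reachable from x by a walk of length ≤ k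
-- inside A (in that graph).

reach : ∀ {n} → List (Pt n) → Pt n → ℕ → List (Pt n)
reach A x zero    = x ∷ []
reach A x (suc k) =
  let R = reach A x k in
  filter (λ y → (y ∈? R) ⊎-dec any? (λ z → dist≤2? z y) R) A

-- connected: any two elements of A are joined by a walk inside A
-- (a walk of length ≤ |A| suffices, as a shortest walk visits distinct vertices)
TwoLinked : ∀ {n} → List (Pt n) → Set
TwoLinked A = All (λ x → All (λ y → Any (y ≡_) (reach A x (length A))) A) A

twoLinked? : ∀ {n} (A : List (Pt n)) → Dec (TwoLinked A)
twoLinked? A = all? (λ x → all? (λ y → y ∈? reach A x (length A)) A) A

IsPolymerCand : ∀ {n} → List (Pt n) → Set
IsPolymerCand A = (0 ℕ.< length A) × TwoLinked A

isPolymerCand? : ∀ {n} (A : List (Pt n)) → Dec (IsPolymerCand A)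
isPolymerCand? A = (0 ℕ.<? length A) ×-dec twoLinked? A

polymers : (n : ℕ) → List (List (Pt n))
polymers n = filter isPolymerCand? (subsets (levelN-1 n) ++ subsets (levelN+1 n))

∂ : ∀ {n} → List (Pt n) → List (Pt n)
∂ {n} A = filter (λ v → any? (λ a → comparable? v a) A) (levelN n)

Compatible : ∀ {n} → List (Pt n) → List (Pt n) → Set
Compatible A B = All (λ v → ¬ Any (v ≡_) (∂ B)) (∂ A)

compatible? : ∀ {n} (A B : List (Pt n)) → Dec (Compatible A B)
compatible? A B = all? (λ v → ¬? (v ∈? ∂ B)) (∂ A)

pow½ : ℕ → ℚ
pow½ zero    = 1ℚ
pow½ (suc k) = ½ ℚ.* pow½ k

wC : ∀ {n} → List (Pt n) → ℚ
wC A = pow½ (length (∂ A))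

sumℚ : List ℚ → ℚ
sumℚ = List.foldr ℚ._+_ 0ℚ

prodℚ : List ℚ → ℚ
prodℚ = List.foldr ℚ._*_ 1ℚ

ΞC : ℕ → ℚ
ΞC n = sumℚ (map (λ Λ → prodℚ (map wC Λ))
                 (filter (allPairs? compatible?) (subsets (polymers n))))

middleLayers : (n : ℕ) → List (Pt n)
middleLayers n = levelN-1 n ++ levelN n ++ levelN+1 n

IsAntichain : ∀ {n} → List (Pt n) → Set
IsAntichain = AllPairs (λ x y → ¬ Comparable x y)

isAntichain? : ∀ {n} (A : List (Pt n)) → Dec (IsAntichain A)
isAntichain? = allPairs? (λ x y → ¬? (comparable? x y))

α-mid : ℕ → ℕ
α-mid n = length (filter isAntichain? (subsets (middleLayers n)))

-- An antichain of [3]^n inside L_{n-1} ∪ L_n ∪ L_{n+1} is a union A ∪ T ∪ B with A ⊆ L_{n-1},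
-- B ⊆ L_{n+1}, no element of A below an element of B, and T ⊆ L_n ∖ ∂(A ∪ B). For a ∈ L_{n-1} and
-- b ∈ L_{n+1}, a ≤ b iff ∂{a} and ∂{b} meet, so summing over T gives α = 2^{ℓ_n} Z, where Z sums
-- 2^{-|∂(A ∪ B)|} over the pairs (A , B) with ∂A ∩ ∂B = ∅. Inside one level, ∂{x} and ∂{y} meet iff
-- x and y are at Hasse distance at most 2, so the 2-linked components of A and of B are polymers
-- with pairwise disjoint boundaries, and 2^{-|∂|} is multiplicative over them. Splitting off a
-- point u together with the polymer containing it, Z and Ξ_C satisfy the same recursion, so Z = Ξ_C.

module Submission where

open import Data.Bool using (true; false; if_then_else_)
open import Data.Empty using (⊥; ⊥-elim)
open import Data.Fin using (Fin; toℕ)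
import Data.Fin.Properties as FinP
open import Data.Fin.Patterns using (0F; 1F; 2F)
import Data.Integer as ℤ
import Data.Integer.Properties as ℤP
open import Data.List using (List; []; _∷_; _++_; filter; length; map)
import Data.List.Properties as LP
open import Data.List.Membership.Propositional using (_∈_; _∉_; find; lose)
import Data.List.Membership.Propositional.Properties as ∈ₚ
open import Data.List.Relation.Binary.Permutation.Propositional as ↭ using (_↭_; ↭-sym)
import Data.List.Relation.Binary.Permutation.Propositional.Properties as ↭ₚ
open import Data.List.Relation.Binary.Subset.Propositional using (_⊆_)
open import Data.List.Relation.Binary.Subset.Propositional.Properties using (Any-resp-⊆; ∷⁺ʳ; ++⁺ˡ)
open import Data.List.Relation.Unary.All as All using (All; []; _∷_; all?)
import Data.List.Relation.Unary.All.Properties as Allₚ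
open import Data.List.Relation.Unary.AllPairs as AllPairs using (AllPairs; []; _∷_; allPairs?)
import Data.List.Relation.Unary.AllPairs.Properties as AllPairsₚ
open import Data.List.Relation.Unary.Any as Any using (Any; here; there; any?)
import Data.List.Relation.Unary.Any.Properties as Anyₚ
open import Data.List.Relation.Unary.Unique.Propositional using (Unique)
import Data.List.Relation.Unary.Unique.Propositional.Properties as Uniqueₚ
open import Data.Nat as ℕ using (ℕ; zero; suc; _+_; _^_; _≤_; _<_; z≤n; s≤s)
import Data.Nat.Coprimality as Coprimality
import Data.Nat.Properties as ℕP
open import Data.Product using (_×_; _,_; proj₁; proj₂; ∃-syntax)
open import Data.Rational as ℚ using (ℚ; 0ℚ; 1ℚ; ½; _/_; mkℚ)
import Data.Rational.Properties as ℚP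
open import Data.Rational.Solver using (module +-*-Solver)
open import Data.Rational.Unnormalised as ℚᵘ using (mkℚᵘ; *≡*)
import Data.Rational.Unnormalised.Properties as ℚᵘP
open import Data.Sum as Sum using (_⊎_; inj₁; inj₂)
open import Data.Vec as Vec using ([]; _∷_)
import Data.Vec.Properties as VecP
open import Data.Vec.Relation.Binary.Pointwise.Inductive as Pointwise using ([]; _∷_)
open import Function using (_∘_)
open import Level using (0ℓ)
open import Relation.Binary.Definitions using (DecidableEquality)
open import Relation.Binary.PropositionalEquality
open import Relation.Nullary using (¬_; Dec; yes; no; does; _×-dec_; _⊎-dec_; ¬?)
open import Relation.Nullary.Decidable using (decidable-stable)
open import Relation.Nullary.Negation using (contradiction)
open import Relation.Unary using (Pred; Decidable)
open import Defs

private variable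
  A B : Set
  n k : ℕ
  x y z : Pt n

Σ : (A → ℚ) → List A → ℚ
Σ f xs = sumℚ (map f xs)

Σ-++ : ∀ (f : A → ℚ) xs ys → Σ f (xs ++ ys) ≡ Σ f xs ℚ.+ Σ f ys
Σ-++ f []       ys = sym (ℚP.+-identityˡ _)
Σ-++ f (x ∷ xs) ys = trans (cong (f x ℚ.+_) (Σ-++ f xs ys)) (sym (ℚP.+-assoc (f x) _ _))

Σ-cong-∈ : ∀ {f g : A → ℚ} xs → (∀ {x} → x ∈ xs → f x ≡ g x) → Σ f xs ≡ Σ g xs
Σ-cong-∈ []       eq = refl
Σ-cong-∈ (x ∷ xs) eq = cong₂ ℚ._+_ (eq (here refl)) (Σ-cong-∈ xs (λ m → eq (there m)))

Σ-cong : ∀ {f g : A → ℚ} xs → (∀ x → f x ≡ g x) → Σ f xs ≡ Σ g xs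
Σ-cong xs eq = Σ-cong-∈ xs (λ {x} _ → eq x)

Σ-zero : (xs : List A) → Σ (λ _ → 0ℚ) xs ≡ 0ℚ
Σ-zero []       = refl
Σ-zero (x ∷ xs) = trans (ℚP.+-identityˡ _) (Σ-zero xs)

Σ-+ : ∀ (f g : A → ℚ) xs → Σ (λ x → f x ℚ.+ g x) xs ≡ Σ f xs ℚ.+ Σ g xs
Σ-+ f g []       = refl
Σ-+ f g (x ∷ xs) =
  trans (cong (f x ℚ.+ g x ℚ.+_) (Σ-+ f g xs)) (+-interchange (f x) (g x) (Σ f xs) (Σ g xs))
  where
  open import Algebra.Bundles using (CommutativeMonoid)
  open import Algebra.Properties.CommutativeSemigroup
    (CommutativeMonoid.commutativeSemigroup ℚP.+-0-commutativeMonoid)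
    using () renaming (interchange to +-interchange)

*-distribˡ-Σ : ∀ c (f : A → ℚ) xs → c ℚ.* Σ f xs ≡ Σ (λ x → c ℚ.* f x) xs
*-distribˡ-Σ c f []       = ℚP.*-zeroʳ c
*-distribˡ-Σ c f (x ∷ xs) =
  trans (ℚP.*-distribˡ-+ c (f x) _) (cong (c ℚ.* f x ℚ.+_) (*-distribˡ-Σ c f xs))

Σ-map : ∀ (f : B → ℚ) (g : A → B) xs → Σ f (map g xs) ≡ Σ (λ x → f (g x)) xs
Σ-map f g xs = cong sumℚ (sym (LP.map-∘ xs))

Σ-comm : ∀ (f : A → B → ℚ) xs ys →
         Σ (λ x → Σ (f x) ys) xs ≡ Σ (λ y → Σ (λ x → f x y) xs) ys
Σ-comm f []       ys = sym (Σ-zero ys)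
Σ-comm f (x ∷ xs) ys = trans (cong (Σ (f x) ys ℚ.+_) (Σ-comm f xs ys))
                             (sym (Σ-+ (f x) (λ y → Σ (λ x′ → f x′ y) xs) ys))

guard : {P : Set} → Dec P → ℚ → ℚ
guard d q = if does d then q else 0ℚ

module _ {P : Set} where

  guard-accept : (d : Dec P) (q : ℚ) → P → guard d q ≡ q
  guard-accept (yes _) q p = refl
  guard-accept (no ¬p) q p = contradiction p ¬p

  guard-reject : (d : Dec P) (q : ℚ) → ¬ P → guard d q ≡ 0ℚ
  guard-reject (yes p) q ¬p = contradiction p ¬p
  guard-reject (no _)  q ¬p = refl

  guard-cong : (d : Dec P) {q r : ℚ} → (P → q ≡ r) → guard d q ≡ guard d r
  guard-cong (yes p) eq = eq p
  guard-cong (no _)  eq = refl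

  guard-*ˡ : (d : Dec P) (c q : ℚ) → c ℚ.* guard d q ≡ guard d (c ℚ.* q)
  guard-*ˡ (yes _) c q = refl
  guard-*ˡ (no _)  c q = ℚP.*-zeroʳ c

  guard-× : {Q : Set} (d : Dec P) (e : Dec Q) (q : ℚ) → guard (d ×-dec e) q ≡ guard d (guard e q)
  guard-× (yes _) (yes _) q = refl
  guard-× (yes _) (no _)  q = refl
  guard-× (no _)  e       q = refl

  guard-⇔ : {Q : Set} (d : Dec P) (e : Dec Q) (q : ℚ) → (P → Q) → (Q → P) → guard d q ≡ guard e q
  guard-⇔ d e q to from with d | e
  ... | yes p | yes _ = refl
  ... | yes p | no ¬q = contradiction (to p) ¬q
  ... | no ¬p | yes q′ = contradiction (from q′) ¬p
  ... | no _  | no _  = refl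

  Σ-guard : ∀ (d : Dec P) (f : A → ℚ) xs → Σ (λ x → guard d (f x)) xs ≡ guard d (Σ f xs)
  Σ-guard (yes _) f xs = refl
  Σ-guard (no _)  f xs = Σ-zero xs

Σ-filter : ∀ {P : Pred A 0ℓ} (P? : Decidable P) (f : A → ℚ) xs →
           Σ f (filter P? xs) ≡ Σ (λ x → guard (P? x) (f x)) xs
Σ-filter P? f []       = refl
Σ-filter P? f (x ∷ xs) with P? x
... | yes _ = cong (f x ℚ.+_) (Σ-filter P? f xs)
... | no _  = trans (Σ-filter P? f xs) (sym (ℚP.+-identityˡ _))

Σ-guard-unique : ∀ {Q : Pred A 0ℓ} (Q? : Decidable Q) (c : ℚ) {xs x} → Unique xs → x ∈ xs → Q x →
                 (∀ {y} → y ∈ xs → Q y → y ≡ x) → Σ (λ y → guard (Q? y) c) xs ≡ c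
Σ-guard-unique Q? c {z ∷ xs} (z∉xs ∷ u) (here refl) qz only =
  trans (cong₂ ℚ._+_ (guard-accept (Q? z) c qz) (trans (Σ-cong-∈ xs rest) (Σ-zero xs)))
        (ℚP.+-identityʳ c)
  where
  rest : ∀ {y} → y ∈ xs → guard (Q? y) c ≡ 0ℚ
  rest y∈xs = guard-reject (Q? _) c (λ qy → All.lookup z∉xs y∈xs (sym (only (there y∈xs) qy)))
Σ-guard-unique Q? c {z ∷ xs} (z∉xs ∷ u) (there x∈xs) qx only =
  trans (cong₂ ℚ._+_ (guard-reject (Q? z) c (λ qz → All.lookup z∉xs x∈xs (only (here refl) qz)))
                     (Σ-guard-unique Q? c u x∈xs qx (λ m → only (there m))))
        (ℚP.+-identityˡ c)

module _ {P Q : Pred A 0ℓ} (P? : Decidable P) (Q? : Decidable Q) where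

  filter-cong-∈ : ∀ xs → (∀ {x} → x ∈ xs → (P x → Q x) × (Q x → P x)) → filter P? xs ≡ filter Q? xs
  filter-cong-∈ []       eq = refl
  filter-cong-∈ (x ∷ xs) eq with ih ← filter-cong-∈ xs (λ m → eq (there m)) | P? x | Q? x
  ... | yes p | yes q = cong (x ∷_) ih
  ... | no _  | no _  = ih
  ... | yes p | no ¬q = contradiction (proj₁ (eq (here refl)) p) ¬q
  ... | no ¬p | yes q = contradiction (proj₂ (eq (here refl)) q) ¬p

  filter-comm : ∀ xs → filter P? (filter Q? xs) ≡ filter Q? (filter P? xs)
  filter-comm []       = refl
  filter-comm (x ∷ xs) with ih ← filter-comm xs | P? x | Q? x
  ... | yes p | yes q rewrite LP.filter-accept P? {xs = filter Q? xs} p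
                            | LP.filter-accept Q? {xs = filter P? xs} q = cong (x ∷_) ih
  ... | yes p | no ¬q rewrite LP.filter-reject Q? {xs = filter P? xs} ¬q = ih
  ... | no ¬p | yes q rewrite LP.filter-reject P? {xs = filter Q? xs} ¬p = ih
  ... | no _  | no _  = ih

  length-filter-⊎ : ∀ xs → (∀ {x} → x ∈ xs → P x → Q x → ⊥) →
    length (filter (λ x → P? x ⊎-dec Q? x) xs) ≡ length (filter P? xs) + length (filter Q? xs)
  length-filter-⊎ []       disj = refl
  length-filter-⊎ (x ∷ xs) disj with ih ← length-filter-⊎ xs (λ m → disj (there m)) | P? x | Q? x
  ... | yes p | yes q = ⊥-elim (disj (here refl) p q)
  ... | yes p | no _  = cong suc ih
  ... | no _  | yes q = trans (cong suc ih) (sym (ℕP.+-suc _ _))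
  ... | no _  | no _  = ih

  length-filter-< : (∀ {x} → P x → Q x) → ∀ {xs s} → s ∈ xs → Q s → ¬ P s →
                    length (filter P? xs) < length (filter Q? xs)
  length-filter-< P⇒Q {x ∷ xs} (here refl) qs ¬ps with P? x | Q? x
  ... | yes ps | _     = contradiction ps ¬ps
  ... | no _   | no ¬q = contradiction qs ¬q
  ... | no _   | yes _ = s≤s (length-filter-≤ xs)
    where
    length-filter-≤ : ∀ ys → length (filter P? ys) ℕ.≤ length (filter Q? ys)
    length-filter-≤ []       = ℕ.z≤n
    length-filter-≤ (y ∷ ys) with P? y | Q? y
    ... | yes _ | yes _ = s≤s (length-filter-≤ ys)
    ... | no _  | yes _ = ℕP.m≤n⇒m≤1+n (length-filter-≤ ys)
    ... | no _  | no _  = length-filter-≤ ys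
    ... | yes p | no ¬q = contradiction (P⇒Q p) ¬q
  length-filter-< P⇒Q {x ∷ xs} (there s∈xs) qs ¬ps with ih ← length-filter-< P⇒Q s∈xs qs ¬ps | P? x | Q? x
  ... | yes _ | yes _ = s≤s ih
  ... | no _  | yes _ = ℕP.m≤n⇒m≤1+n ih
  ... | no _  | no _  = ih
  ... | yes p | no ¬q = contradiction (P⇒Q p) ¬q

length-filter-∁ : ∀ {P : Pred A 0ℓ} (P? : Decidable P) xs →
                  length (filter (λ x → ¬? (P? x)) xs) + length (filter P? xs) ≡ length xs
length-filter-∁ P? []       = refl
length-filter-∁ P? (x ∷ xs) with ih ← length-filter-∁ P? xs | P? x
... | yes _ = trans (ℕP.+-suc _ _) (cong suc ih)
... | no _  = cong suc ih

AllPairs-++⁻ : ∀ {R : A → A → Set} xs {ys} → AllPairs R (xs ++ ys) →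
               AllPairs R xs × AllPairs R ys × All (λ x → All (R x) ys) xs
AllPairs-++⁻ []       R-ys          = [] , R-ys , []
AllPairs-++⁻ (x ∷ xs) (R-x ∷ R-rest) =
  let R-xs , R-ys , R-cross = AllPairs-++⁻ xs R-rest
  in Allₚ.++⁻ˡ xs R-x ∷ R-xs , R-ys , Allₚ.++⁻ʳ xs R-x ∷ R-cross

Σ-subsets-∷ : ∀ (f : List A → ℚ) x xs →
              Σ f (subsets (x ∷ xs)) ≡ Σ f (subsets xs) ℚ.+ Σ (λ S → f (x ∷ S)) (subsets xs)
Σ-subsets-∷ f x xs = trans (Σ-++ f (subsets xs) _) (cong (Σ f (subsets xs) ℚ.+_) (Σ-map f (x ∷_) (subsets xs)))

∈-subsets⁻ : ∀ (x : A) xs {S} → S ∈ subsets (x ∷ xs) →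
             S ∈ subsets xs ⊎ ∃[ S′ ] S′ ∈ subsets xs × S ≡ x ∷ S′
∈-subsets⁻ x xs S∈ with ∈ₚ.∈-++⁻ (subsets xs) S∈
... | inj₁ S∈xs = inj₁ S∈xs
... | inj₂ S∈map with ∈ₚ.∈-map⁻ _ S∈map
...   | S′ , S′∈ , refl = inj₂ (S′ , S′∈ , refl)

∈-subsets⁺ʳ : ∀ {x : A} {xs S} → S ∈ subsets xs → x ∷ S ∈ subsets (x ∷ xs)
∈-subsets⁺ʳ {xs = xs} S∈ = ∈ₚ.∈-++⁺ʳ (subsets xs) (∈ₚ.∈-map⁺ _ S∈)

[]∈subsets : (xs : List A) → [] ∈ subsets xs
[]∈subsets []       = here refl
[]∈subsets (x ∷ xs) = ∈ₚ.∈-++⁺ˡ ([]∈subsets xs)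

filter∈subsets : ∀ {P : Pred A 0ℓ} (P? : Decidable P) xs → filter P? xs ∈ subsets xs
filter∈subsets P? []       = here refl
filter∈subsets P? (x ∷ xs) with does (P? x)
... | true  = ∈-subsets⁺ʳ {xs = xs} (filter∈subsets P? xs)
... | false = ∈ₚ.∈-++⁺ˡ (filter∈subsets P? xs)

∈-subsets⇒⊆ : ∀ {xs : List A} {S} → S ∈ subsets xs → S ⊆ xs
∈-subsets⇒⊆ {xs = []}     (here refl) ()
∈-subsets⇒⊆ {xs = x ∷ xs} S∈ y∈S with ∈-subsets⁻ x xs S∈
... | inj₁ S∈xs = there (∈-subsets⇒⊆ S∈xs y∈S)
... | inj₂ (S′ , S′∈ , refl) with y∈S
...   | here y≡x    = here y≡x
...   | there y∈S′  = there (∈-subsets⇒⊆ S′∈ y∈S′)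

∈-subsets⇒Unique : ∀ {xs : List A} {S} → Unique xs → S ∈ subsets xs → Unique S
∈-subsets⇒Unique {xs = []}     _           (here refl) = []
∈-subsets⇒Unique {xs = x ∷ xs} (x∉xs ∷ u) S∈ with ∈-subsets⁻ x xs S∈
... | inj₁ S∈xs = ∈-subsets⇒Unique u S∈xs
... | inj₂ (S′ , S′∈ , refl) =
  All.tabulate (λ y∈S′ → All.lookup x∉xs (∈-subsets⇒⊆ S′∈ y∈S′)) ∷ ∈-subsets⇒Unique u S′∈

subsets-Unique : ∀ {xs : List A} → Unique xs → Unique (subsets xs)
subsets-Unique {xs = []}     _           = [] ∷ []
subsets-Unique {xs = x ∷ xs} (x∉xs ∷ u) =
  Uniqueₚ.++⁺ ih (Uniqueₚ.map⁺ LP.∷-injectiveʳ ih) disjoint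
  where
  ih = subsets-Unique u
  disjoint : ∀ {S} → S ∈ subsets xs × S ∈ map (x ∷_) (subsets xs) → ⊥
  disjoint (S∈ , S∈map) with ∈ₚ.∈-map⁻ _ S∈map
  ... | S′ , _ , refl = All.lookup x∉xs (∈-subsets⇒⊆ S∈ (here refl)) refl

length-subsets : (xs : List A) → length (subsets xs) ≡ 2 ^ length xs
length-subsets []       = refl
length-subsets (x ∷ xs) = begin
  length (subsets xs ++ map (x ∷_) (subsets xs))          ≡⟨ LP.length-++ (subsets xs) ⟩
  length (subsets xs) + length (map (x ∷_) (subsets xs))  ≡⟨ cong (length (subsets xs) +_) (LP.length-map _ (subsets xs)) ⟩
  length (subsets xs) + length (subsets xs)               ≡⟨ cong (λ k → k + k) (length-subsets xs) ⟩
  2 ^ length xs + 2 ^ length xs                           ≡⟨ cong (2 ^ length xs +_) (ℕP.+-identityʳ _) ⟨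
  2 ^ length (x ∷ xs)                                     ∎
  where open ≡-Reasoning

module _ {P : Pred A 0ℓ} (P? : Decidable P) {x : A} where

  filter-all-map-∷ : P x → ∀ Ss → filter (all? P?) (map (x ∷_) Ss) ≡ map (x ∷_) (filter (all? P?) Ss)
  filter-all-map-∷ px []       = refl
  filter-all-map-∷ px (S ∷ Ss) with P? x | all? P? S
  ... | no ¬px | _     = contradiction px ¬px
  ... | yes _  | yes _ = cong ((x ∷ S) ∷_) (filter-all-map-∷ px Ss)
  ... | yes _  | no _  = filter-all-map-∷ px Ss

  filter-all-map-∷-reject : ¬ P x → ∀ Ss → filter (all? P?) (map (x ∷_) Ss) ≡ []
  filter-all-map-∷-reject ¬px []       = refl
  filter-all-map-∷-reject ¬px (S ∷ Ss) with P? x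
  ... | yes px = contradiction px ¬px
  ... | no _   = filter-all-map-∷-reject ¬px Ss

subsets-filter : ∀ {P : Pred A 0ℓ} (P? : Decidable P) xs →
                 subsets (filter P? xs) ≡ filter (all? P?) (subsets xs)
subsets-filter P? []       = refl
subsets-filter P? (x ∷ xs) with P? x
... | yes px = begin
  subsets (filter P? xs) ++ map (x ∷_) (subsets (filter P? xs))
    ≡⟨ cong (λ L → L ++ map (x ∷_) L) (subsets-filter P? xs) ⟩
  filter (all? P?) (subsets xs) ++ map (x ∷_) (filter (all? P?) (subsets xs))
    ≡⟨ cong (filter (all? P?) (subsets xs) ++_) (sym (filter-all-map-∷ P? px (subsets xs))) ⟩
  filter (all? P?) (subsets xs) ++ filter (all? P?) (map (x ∷_) (subsets xs))
    ≡⟨ sym (LP.filter-++ (all? P?) (subsets xs) _) ⟩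
  filter (all? P?) (subsets (x ∷ xs)) ∎
  where open ≡-Reasoning
... | no ¬px = begin
  subsets (filter P? xs)
    ≡⟨ subsets-filter P? xs ⟩
  filter (all? P?) (subsets xs)
    ≡⟨ sym (LP.++-identityʳ _) ⟩
  filter (all? P?) (subsets xs) ++ []
    ≡⟨ cong (filter (all? P?) (subsets xs) ++_) (sym (filter-all-map-∷-reject P? ¬px (subsets xs))) ⟩
  filter (all? P?) (subsets xs) ++ filter (all? P?) (map (x ∷_) (subsets xs))
    ≡⟨ sym (LP.filter-++ (all? P?) (subsets xs) _) ⟩
  filter (all? P?) (subsets (x ∷ xs)) ∎
  where open ≡-Reasoning

Σ-subsets-++ : ∀ (f : List A → ℚ) xs ys →
  Σ f (subsets (xs ++ ys)) ≡ Σ (λ S → Σ (λ T → f (S ++ T)) (subsets ys)) (subsets xs)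
Σ-subsets-++ f []       ys = sym (ℚP.+-identityʳ _)
Σ-subsets-++ f (x ∷ xs) ys = begin
  Σ f (subsets (x ∷ xs ++ ys))
    ≡⟨ Σ-subsets-∷ f x (xs ++ ys) ⟩
  Σ f (subsets (xs ++ ys)) ℚ.+ Σ (λ S → f (x ∷ S)) (subsets (xs ++ ys))
    ≡⟨ cong₂ ℚ._+_ (Σ-subsets-++ f xs ys) (Σ-subsets-++ (λ S → f (x ∷ S)) xs ys) ⟩
  Σ g (subsets xs) ℚ.+ Σ (λ S → g (x ∷ S)) (subsets xs)
    ≡⟨ sym (Σ-subsets-∷ g x xs) ⟩
  Σ g (subsets (x ∷ xs)) ∎
  where
  open ≡-Reasoning
  g = λ S → Σ (λ T → f (S ++ T)) (subsets ys)

module Difference {A : Set} (_≟_ : DecidableEquality A) where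

  open import Data.List.Membership.DecPropositional _≟_ using () renaming (_∈?_ to _∈ᴬ?_)

  infixl 6 _∖_
  _∖_ : List A → List A → List A
  S ∖ C = filter (λ y → ¬? (y ∈ᴬ? C)) S

  ++-∖-⊆ : ∀ {C S} → C ⊆ S → C ++ S ∖ C ⊆ S
  ++-∖-⊆ {C} {S} C⊆S y∈ with ∈ₚ.∈-++⁻ C y∈
  ... | inj₁ y∈C   = C⊆S y∈C
  ... | inj₂ y∈S∖C = proj₁ (∈ₚ.∈-filter⁻ (λ y → ¬? (y ∈ᴬ? C)) {xs = S} y∈S∖C)

  ⊆-++-∖ : ∀ {C S} → S ⊆ C ++ S ∖ C
  ⊆-++-∖ {C} {S} {y} y∈S with y ∈ᴬ? C
  ... | yes y∈C = ∈ₚ.∈-++⁺ˡ y∈C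
  ... | no y∉C  = ∈ₚ.∈-++⁺ʳ C (∈ₚ.∈-filter⁺ (λ y → ¬? (y ∈ᴬ? C)) y∈S y∉C)

  ∈-subsets⇒≡filter : ∀ {xs C} → Unique xs → C ∈ subsets xs → C ≡ filter (_∈ᴬ? C) xs
  ∈-subsets⇒≡filter {[]}     _           (here refl) = refl
  ∈-subsets⇒≡filter {x ∷ xs} (x∉xs ∷ u) C∈ with ∈-subsets⁻ x xs C∈
  ... | inj₁ C∈xs = trans (∈-subsets⇒≡filter u C∈xs) (sym (LP.filter-reject (_∈ᴬ? _) x∉C))
    where
    x∉C : x ∉ _
    x∉C x∈C = All.lookup x∉xs (∈-subsets⇒⊆ C∈xs x∈C) refl
  ... | inj₂ (C′ , C′∈ , refl) =
    trans (cong (x ∷_) (trans (∈-subsets⇒≡filter u C′∈) (filter-cong-∈ (_∈ᴬ? C′) (_∈ᴬ? (x ∷ C′)) xs same)))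
          (sym (LP.filter-accept (_∈ᴬ? (x ∷ C′)) (here refl)))
    where
    same : ∀ {y} → y ∈ xs → (y ∈ C′ → y ∈ x ∷ C′) × (y ∈ x ∷ C′ → y ∈ C′)
    same y∈xs = there , λ { (here refl) → ⊥-elim (All.lookup x∉xs y∈xs refl) ; (there y∈C′) → y∈C′ }

  subsets-ext : ∀ {xs C₁ C₂} → Unique xs → C₁ ∈ subsets xs → C₂ ∈ subsets xs →
                C₁ ⊆ C₂ → C₂ ⊆ C₁ → C₁ ≡ C₂
  subsets-ext {xs} {C₁} {C₂} u C₁∈ C₂∈ C₁⊆C₂ C₂⊆C₁ = begin
    C₁                    ≡⟨ ∈-subsets⇒≡filter u C₁∈ ⟩
    filter (_∈ᴬ? C₁) xs    ≡⟨ filter-cong-∈ (_∈ᴬ? C₁) (_∈ᴬ? C₂) xs (λ _ → C₁⊆C₂ , C₂⊆C₁) ⟩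
    filter (_∈ᴬ? C₂) xs    ≡⟨ ∈-subsets⇒≡filter u C₂∈ ⟨
    C₂                    ∎
    where open ≡-Reasoning

  Σ-∖-∷ : ∀ (φ : List A → List A → ℚ) {x S} → x ∉ S →
          Σ (λ C → φ C ((x ∷ S) ∖ C)) (subsets (x ∷ S))
          ≡ Σ (λ C → φ C (x ∷ S ∖ C)) (subsets S) ℚ.+ Σ (λ C → φ (x ∷ C) (S ∖ C)) (subsets S)
  Σ-∖-∷ φ {x} {S} x∉S =
    trans (Σ-subsets-∷ _ x S) (cong₂ ℚ._+_ (Σ-cong-∈ (subsets S) x∉C) (Σ-cong (subsets S) x∈C))
    where
    x∉C : ∀ {C} → C ∈ subsets S → φ C ((x ∷ S) ∖ C) ≡ φ C (x ∷ S ∖ C)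
    x∉C C∈ = cong (φ _) (LP.filter-accept (λ y → ¬? (y ∈ᴬ? _)) (λ x∈C → x∉S (∈-subsets⇒⊆ C∈ x∈C)))
    x∈C : ∀ C → φ (x ∷ C) ((x ∷ S) ∖ (x ∷ C)) ≡ φ (x ∷ C) (S ∖ C)
    x∈C C = cong (φ (x ∷ C)) (trans (LP.filter-reject (λ y → ¬? (y ∈ᴬ? (x ∷ C))) (λ x∉ → x∉ (here refl)))
                                    (filter-cong-∈ _ _ S (λ y∈S → (λ y∉ y∈C → y∉ (there y∈C)) , drop-x y∈S)))
      where
      drop-x : ∀ {y} → y ∈ S → ¬ y ∈ C → ¬ y ∈ x ∷ C
      drop-x y∈S y∉C (here refl)  = x∉S y∈S
      drop-x y∈S y∉C (there y∈C) = y∉C y∈C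

  -- Both sides sum ψ over the pairs of disjoint subsets of V, indexed as (C , R) resp. (C , S ∖ C).
  Σ-disjoint-pairs : ∀ V → Unique V → (ψ : List A → List A → ℚ) →
    (∀ {C R y} → C ∈ subsets V → y ∈ C → y ∈ R → ψ C R ≡ 0ℚ) →
    Σ (λ C → Σ (ψ C) (subsets V)) (subsets V) ≡ Σ (λ S → Σ (λ C → ψ C (S ∖ C)) (subsets S)) (subsets V)
  Σ-disjoint-pairs []      _           ψ vanish = refl
  Σ-disjoint-pairs (x ∷ V) (x∉V ∷ V!) ψ vanish = begin
    Σ (λ C → Σ (ψ C) (subsets (x ∷ V))) (subsets (x ∷ V))
      ≡⟨ Σ-subsets-∷ _ x V ⟩
    Σ (λ C → Σ (ψ C) (subsets (x ∷ V))) s ℚ.+ Σ (λ C → Σ (ψ (x ∷ C)) (subsets (x ∷ V))) s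
      ≡⟨ cong₂ ℚ._+_ (trans (Σ-cong s (λ C → Σ-subsets-∷ (ψ C) x V)) (Σ-+ _ _ s))
                     (trans (Σ-cong s (λ C → Σ-subsets-∷ (ψ (x ∷ C)) x V)) (Σ-+ _ _ s)) ⟩
    (ΣΣ ψ ℚ.+ ΣΣ ψ₁) ℚ.+ (ΣΣ ψ₂ ℚ.+ Σ (λ C → Σ (λ R → ψ (x ∷ C) (x ∷ R)) s) s)
      ≡⟨ cong (λ z → (ΣΣ ψ ℚ.+ ΣΣ ψ₁) ℚ.+ (ΣΣ ψ₂ ℚ.+ z))
              (trans (Σ-cong-∈ s (λ C∈ → trans (Σ-cong s (λ _ → vanish (x∷ C∈) (here refl) (here refl))) (Σ-zero s)))
                     (Σ-zero s)) ⟩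
    (ΣΣ ψ ℚ.+ ΣΣ ψ₁) ℚ.+ (ΣΣ ψ₂ ℚ.+ 0ℚ)
      ≡⟨ cong₂ (λ a b → a ℚ.+ (b ℚ.+ 0ℚ))
               (cong₂ ℚ._+_ (Σ-disjoint-pairs V V! ψ (λ C∈ → vanish (∈ₚ.∈-++⁺ˡ C∈)))
                            (Σ-disjoint-pairs V V! ψ₁ (λ C∈ y∈C y∈R →
                               vanish (∈ₚ.∈-++⁺ˡ C∈) y∈C (there y∈R))))
               (Σ-disjoint-pairs V V! ψ₂ (λ C∈ y∈C → vanish (x∷ C∈) (there y∈C))) ⟩
    (Σ f₀ s ℚ.+ Σ f₁ s) ℚ.+ (Σ f₂ s ℚ.+ 0ℚ)
      ≡⟨ trans (cong ((Σ f₀ s ℚ.+ Σ f₁ s) ℚ.+_) (ℚP.+-identityʳ (Σ f₂ s)))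
               (ℚP.+-assoc (Σ f₀ s) (Σ f₁ s) (Σ f₂ s)) ⟩
    Σ f₀ s ℚ.+ (Σ f₁ s ℚ.+ Σ f₂ s)
      ≡⟨ cong (Σ f₀ s ℚ.+_) (trans (sym (Σ-+ f₁ f₂ s)) (Σ-cong-∈ s (λ S∈ → sym (Σ-∖-∷ ψ (x∉ S∈))))) ⟩
    Σ f₀ s ℚ.+ Σ (λ S → f₀ (x ∷ S)) s
      ≡⟨ Σ-subsets-∷ f₀ x V ⟨
    Σ f₀ (subsets (x ∷ V)) ∎
    where
    open ≡-Reasoning
    s = subsets V
    ΣΣ : (List A → List A → ℚ) → ℚ
    ΣΣ φ = Σ (λ C → Σ (φ C) s) s
    ψ₁ ψ₂ : List A → List A → ℚ
    ψ₁ C R = ψ C (x ∷ R)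
    ψ₂ C R = ψ (x ∷ C) R
    f₀ f₁ f₂ : List A → ℚ
    f₀ S = Σ (λ C → ψ  C (S ∖ C)) (subsets S)
    f₁ S = Σ (λ C → ψ₁ C (S ∖ C)) (subsets S)
    f₂ S = Σ (λ C → ψ₂ C (S ∖ C)) (subsets S)
    x∉ : ∀ {S} → S ∈ s → x ∉ S
    x∉ S∈ x∈S = All.lookup x∉V (∈-subsets⇒⊆ S∈ x∈S) refl
    x∷ : ∀ {C} → C ∈ s → x ∷ C ∈ subsets (x ∷ V)
    x∷ = ∈-subsets⁺ʳ {xs = V}

fromℕ : ℕ → ℚ
fromℕ k = ℤ.+ k / 1

private
  -- `+ k / 1` is already in normal form, so sums and products can be computed on unnormalised representatives.
  ι : ℕ → ℚ
  ι k = mkℚ (ℤ.+ k) 0 (Coprimality.sym (Coprimality.1-coprimeTo k))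

  fromℕ≡ι : ∀ k → fromℕ k ≡ ι k
  fromℕ≡ι k = ℚP.normalize-coprime (Coprimality.sym (Coprimality.1-coprimeTo k))

fromℕ-+ : ∀ a b → fromℕ (a + b) ≡ fromℕ a ℚ.+ fromℕ b
fromℕ-+ a b rewrite fromℕ≡ι (a + b) | fromℕ≡ι a | fromℕ≡ι b =
  ℚP.toℚᵘ-injective (ℚᵘP.≃-trans integral (ℚᵘP.≃-sym (ℚP.toℚᵘ-homo-+ (ι a) (ι b))))
  where
  integral : mkℚᵘ (ℤ.+ (a + b)) 0 ℚᵘ.≃ mkℚᵘ (ℤ.+ a) 0 ℚᵘ.+ mkℚᵘ (ℤ.+ b) 0
  integral = *≡* (cong (ℤ._* ℤ.+ 1) (cong₂ ℤ._+_ (sym (ℤP.*-identityʳ (ℤ.+ a))) (sym (ℤP.*-identityʳ (ℤ.+ b)))))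

fromℕ-* : ∀ a b → fromℕ (a ℕ.* b) ≡ fromℕ a ℚ.* fromℕ b
fromℕ-* a b rewrite fromℕ≡ι (a ℕ.* b) | fromℕ≡ι a | fromℕ≡ι b =
  ℚP.toℚᵘ-injective (ℚᵘP.≃-trans integral (ℚᵘP.≃-sym (ℚP.toℚᵘ-homo-* (ι a) (ι b))))
  where
  integral : mkℚᵘ (ℤ.+ (a ℕ.* b)) 0 ℚᵘ.≃ mkℚᵘ (ℤ.+ a) 0 ℚᵘ.* mkℚᵘ (ℤ.+ b) 0
  integral = *≡* (cong (ℤ._* ℤ.+ 1) (ℤP.pos-* a b))

Σ-one : (xs : List A) → Σ (λ _ → 1ℚ) xs ≡ fromℕ (length xs)
Σ-one []       = refl
Σ-one (x ∷ xs) = trans (cong (1ℚ ℚ.+_) (Σ-one xs)) (sym (fromℕ-+ 1 (length xs)))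

pow½-+ : ∀ a b → pow½ (a + b) ≡ pow½ a ℚ.* pow½ b
pow½-+ zero    b = sym (ℚP.*-identityˡ _)
pow½-+ (suc a) b = trans (cong (½ ℚ.*_) (pow½-+ a b)) (sym (ℚP.*-assoc ½ (pow½ a) (pow½ b)))

2^*pow½ : ∀ b → fromℕ (2 ^ b) ℚ.* pow½ b ≡ 1ℚ
2^*pow½ zero    = refl
2^*pow½ (suc b) = begin
  fromℕ (2 ℕ.* 2 ^ b) ℚ.* (½ ℚ.* pow½ b)            ≡⟨ cong (ℚ._* (½ ℚ.* pow½ b)) (fromℕ-* 2 (2 ^ b)) ⟩
  (fromℕ 2 ℚ.* fromℕ (2 ^ b)) ℚ.* (½ ℚ.* pow½ b)
    ≡⟨ solve 4 (λ p q r s → (p :* q) :* (r :* s) := (p :* r) :* (q :* s)) refl (fromℕ 2) (fromℕ (2 ^ b)) ½ (pow½ b) ⟩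
  (fromℕ 2 ℚ.* ½) ℚ.* (fromℕ (2 ^ b) ℚ.* pow½ b)    ≡⟨ cong ((fromℕ 2 ℚ.* ½) ℚ.*_) (2^*pow½ b) ⟩
  1ℚ                                                ∎
  where
  open ≡-Reasoning
  open +-*-Solver

2^-split : ∀ {a b c} → a + b ≡ c → fromℕ (2 ^ a) ≡ fromℕ (2 ^ c) ℚ.* pow½ b
2^-split {a} {b} refl = begin
  fromℕ (2 ^ a)                                   ≡⟨ ℚP.*-identityʳ _ ⟨
  fromℕ (2 ^ a) ℚ.* 1ℚ                            ≡⟨ cong (fromℕ (2 ^ a) ℚ.*_) (2^*pow½ b) ⟨
  fromℕ (2 ^ a) ℚ.* (fromℕ (2 ^ b) ℚ.* pow½ b)    ≡⟨ ℚP.*-assoc (fromℕ (2 ^ a)) _ _ ⟨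
  (fromℕ (2 ^ a) ℚ.* fromℕ (2 ^ b)) ℚ.* pow½ b    ≡⟨ cong (ℚ._* pow½ b) (fromℕ-* (2 ^ a) (2 ^ b)) ⟨
  fromℕ (2 ^ a ℕ.* 2 ^ b) ℚ.* pow½ b              ≡⟨ cong (λ k → fromℕ k ℚ.* pow½ b) (ℕP.^-distribˡ-+-* 2 a b) ⟨
  fromℕ (2 ^ (a + b)) ℚ.* pow½ b                  ∎
  where open ≡-Reasoning

-- Polymer models

module PolymerModel {B : Set} {_#_ : B → B → Set} (_#?_ : ∀ x y → Dec (x # y))
                    (#-sym : ∀ {x y} → x # y → y # x) (w : B → ℚ) where

  open +-*-Solver

  weight : List B → ℚ
  weight Λ = prodℚ (map w Λ)

  Ξ : List B → ℚ
  Ξ P = Σ weight (filter (allPairs? _#?_) (subsets P))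

  compatibles : B → List B → List B
  compatibles p = filter (p #?_)

  private
    filter-pairwise-map-∷ : ∀ p Λs → filter (allPairs? _#?_) (map (p ∷_) Λs)
                                     ≡ map (p ∷_) (filter (allPairs? _#?_) (filter (all? (p #?_)) Λs))
    filter-pairwise-map-∷ p []       = refl
    filter-pairwise-map-∷ p (Λ ∷ Λs) with ih ← filter-pairwise-map-∷ p Λs | all? (p #?_) Λ
    ... | no _  = ih
    ... | yes _ with allPairs? _#?_ Λ
    ...   | yes _ = cong ((p ∷ Λ) ∷_) ih
    ...   | no _  = ih

  Ξ-cons : ∀ p P → Ξ (p ∷ P) ≡ Ξ P ℚ.+ w p ℚ.* Ξ (compatibles p P)
  Ξ-cons p P = begin
    Σ weight (filter (allPairs? _#?_) (subsets P ++ map (p ∷_) (subsets P)))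
      ≡⟨ cong (Σ weight) (LP.filter-++ (allPairs? _#?_) (subsets P) _) ⟩
    Σ weight (filter (allPairs? _#?_) (subsets P) ++ filter (allPairs? _#?_) (map (p ∷_) (subsets P)))
      ≡⟨ Σ-++ weight (filter (allPairs? _#?_) (subsets P)) _ ⟩
    Ξ P ℚ.+ Σ weight (filter (allPairs? _#?_) (map (p ∷_) (subsets P)))
      ≡⟨ cong (λ L → Ξ P ℚ.+ Σ weight L) (filter-pairwise-map-∷ p (subsets P)) ⟩
    Ξ P ℚ.+ Σ weight (map (p ∷_) (filter (allPairs? _#?_) (filter (all? (p #?_)) (subsets P))))
      ≡⟨ cong (λ L → Ξ P ℚ.+ Σ weight (map (p ∷_) (filter (allPairs? _#?_) L))) (subsets-filter (p #?_) P) ⟨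
    Ξ P ℚ.+ Σ weight (map (p ∷_) (filter (allPairs? _#?_) (subsets (compatibles p P))))
      ≡⟨ cong (Ξ P ℚ.+_) (trans (Σ-map weight (p ∷_) Λs) (sym (*-distribˡ-Σ (w p) weight Λs))) ⟩
    Ξ P ℚ.+ w p ℚ.* Ξ (compatibles p P) ∎
    where
    open ≡-Reasoning
    Λs = filter (allPairs? _#?_) (subsets (compatibles p P))

  private
    pullout : ∀ k P p Q → length P ≤ k →
              Ξ (P ++ p ∷ Q) ≡ Ξ (P ++ Q) ℚ.+ w p ℚ.* Ξ (compatibles p (P ++ Q))
    pullout k       []      p Q _         = Ξ-cons p Q
    pullout (suc k) (a ∷ P) p Q (s≤s |P|≤k) with a #? p
    ... | yes a#p = begin
      Ξ (a ∷ P ++ p ∷ Q)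
        ≡⟨ Ξ-cons a (P ++ p ∷ Q) ⟩
      Ξ (P ++ p ∷ Q) ℚ.+ w a ℚ.* Ξ (compatibles a (P ++ p ∷ Q))
        ≡⟨ cong (λ L → Ξ (P ++ p ∷ Q) ℚ.+ w a ℚ.* Ξ L)
                (trans (LP.filter-++ (a #?_) P (p ∷ Q)) (cong (compatibles a P ++_) (LP.filter-accept (a #?_) a#p))) ⟩
      Ξ (P ++ p ∷ Q) ℚ.+ w a ℚ.* Ξ (compatibles a P ++ p ∷ compatibles a Q)
        ≡⟨ cong₂ (λ x y → x ℚ.+ w a ℚ.* y) (pullout k P p Q |P|≤k)
                 (pullout k (compatibles a P) p (compatibles a Q) (ℕP.≤-trans (LP.length-filter (a #?_) P) |P|≤k)) ⟩
      (Ξ PQ ℚ.+ w p ℚ.* Ξ (fp PQ)) ℚ.+ w a ℚ.* (Ξ (fa P ++ fa Q) ℚ.+ w p ℚ.* Ξ (fp (fa P ++ fa Q)))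
        ≡⟨ cong (λ L → (Ξ PQ ℚ.+ w p ℚ.* Ξ (fp PQ)) ℚ.+ w a ℚ.* (Ξ L ℚ.+ w p ℚ.* Ξ (fp L)))
                (LP.filter-++ (a #?_) P Q) ⟨
      (Ξ PQ ℚ.+ w p ℚ.* Ξ (fp PQ)) ℚ.+ w a ℚ.* (Ξ (fa PQ) ℚ.+ w p ℚ.* Ξ (fp (fa PQ)))
        ≡⟨ cong (λ L → (Ξ PQ ℚ.+ w p ℚ.* Ξ (fp PQ)) ℚ.+ w a ℚ.* (Ξ (fa PQ) ℚ.+ w p ℚ.* Ξ L))
                (filter-comm (p #?_) (a #?_) PQ) ⟩
      (Ξ PQ ℚ.+ w p ℚ.* Ξ (fp PQ)) ℚ.+ w a ℚ.* (Ξ (fa PQ) ℚ.+ w p ℚ.* Ξ (fa (fp PQ)))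
        ≡⟨ solve 7 (λ A B C D E F G → (A :+ B :* C) :+ D :* (E :+ B :* G) := (A :+ D :* E) :+ B :* (C :+ D :* G))
                 refl (Ξ PQ) (w p) (Ξ (fp PQ)) (w a) (Ξ (fa PQ)) (Ξ (fp (fa PQ))) (Ξ (fa (fp PQ))) ⟩
      (Ξ PQ ℚ.+ w a ℚ.* Ξ (fa PQ)) ℚ.+ w p ℚ.* (Ξ (fp PQ) ℚ.+ w a ℚ.* Ξ (fa (fp PQ)))
        ≡⟨ cong₂ (λ x y → x ℚ.+ w p ℚ.* y) (Ξ-cons a PQ) (Ξ-cons a (fp PQ)) ⟨
      Ξ (a ∷ PQ) ℚ.+ w p ℚ.* Ξ (a ∷ fp PQ)
        ≡⟨ cong (λ L → Ξ (a ∷ PQ) ℚ.+ w p ℚ.* Ξ L) (LP.filter-accept (p #?_) (#-sym a#p)) ⟨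
      Ξ (a ∷ PQ) ℚ.+ w p ℚ.* Ξ (fp (a ∷ PQ)) ∎
      where
      open ≡-Reasoning
      PQ = P ++ Q
      fa = compatibles a
      fp = compatibles p
    ... | no ¬a#p = begin
      Ξ (a ∷ P ++ p ∷ Q)
        ≡⟨ Ξ-cons a (P ++ p ∷ Q) ⟩
      Ξ (P ++ p ∷ Q) ℚ.+ w a ℚ.* Ξ (compatibles a (P ++ p ∷ Q))
        ≡⟨ cong (λ L → Ξ (P ++ p ∷ Q) ℚ.+ w a ℚ.* Ξ L)
                (trans (LP.filter-++ (a #?_) P (p ∷ Q))
                       (trans (cong (compatibles a P ++_) (LP.filter-reject (a #?_) ¬a#p)) (sym (LP.filter-++ (a #?_) P Q)))) ⟩
      Ξ (P ++ p ∷ Q) ℚ.+ w a ℚ.* Ξ (fa PQ)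
        ≡⟨ cong (ℚ._+ w a ℚ.* Ξ (fa PQ)) (pullout k P p Q |P|≤k) ⟩
      (Ξ PQ ℚ.+ w p ℚ.* Ξ (fp PQ)) ℚ.+ w a ℚ.* Ξ (fa PQ)
        ≡⟨ solve 5 (λ A B C D E → (A :+ B :* C) :+ D :* E := (A :+ D :* E) :+ B :* C)
                 refl (Ξ PQ) (w p) (Ξ (fp PQ)) (w a) (Ξ (fa PQ)) ⟩
      (Ξ PQ ℚ.+ w a ℚ.* Ξ (fa PQ)) ℚ.+ w p ℚ.* Ξ (fp PQ)
        ≡⟨ cong₂ (λ x y → x ℚ.+ w p ℚ.* Ξ y) (Ξ-cons a PQ) (LP.filter-reject (p #?_) (¬a#p ∘ #-sym)) ⟨
      Ξ (a ∷ PQ) ℚ.+ w p ℚ.* Ξ (fp (a ∷ PQ)) ∎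
      where
      open ≡-Reasoning
      PQ = P ++ Q
      fa = compatibles a
      fp = compatibles p

  Ξ-pullout : ∀ P p Q → Ξ (P ++ p ∷ Q) ≡ Ξ (P ++ Q) ℚ.+ w p ℚ.* Ξ (compatibles p (P ++ Q))
  Ξ-pullout P p Q = pullout (length P) P p Q ℕP.≤-refl

  private
    perm : ∀ k P P′ → length P ≤ k → P ↭ P′ → Ξ P ≡ Ξ P′
    perm k [] P′ _ []↭P′ rewrite ↭ₚ.↭-empty-inv (↭-sym []↭P′) = refl
    perm (suc k) (p ∷ P) P′ (s≤s |P|≤k) p∷P↭P′ with ∈ₚ.∈-∃++ (↭ₚ.∈-resp-↭ p∷P↭P′ (here refl))
    ... | A , B , refl = begin
      Ξ (p ∷ P)                                        ≡⟨ Ξ-cons p P ⟩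
      Ξ P ℚ.+ w p ℚ.* Ξ (compatibles p P)              ≡⟨ cong₂ (λ x y → x ℚ.+ w p ℚ.* y)
                                                            (perm k P (A ++ B) |P|≤k P↭AB)
                                                            (perm k (compatibles p P) (compatibles p (A ++ B))
                                                               (ℕP.≤-trans (LP.length-filter (p #?_) P) |P|≤k)
                                                               (↭ₚ.filter-↭ (p #?_) P↭AB)) ⟩
      Ξ (A ++ B) ℚ.+ w p ℚ.* Ξ (compatibles p (A ++ B)) ≡⟨ Ξ-pullout A p B ⟨
      Ξ (A ++ p ∷ B)                                   ∎
      where
      open ≡-Reasoning
      P↭AB : P ↭ A ++ B
      P↭AB = ↭ₚ.drop-mid [] A p∷P↭P′

  Ξ-perm : ∀ {P P′} → P ↭ P′ → Ξ P ≡ Ξ P′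
  Ξ-perm {P} = perm (length P) P _ ℕP.≤-refl

  Ξ-clique : ∀ (Qs R : List B) → (∀ {q q′} → q ∈ Qs → q′ ∈ Qs → ¬ q # q′) →
             Ξ (Qs ++ R) ≡ Ξ R ℚ.+ Σ (λ q → w q ℚ.* Ξ (compatibles q R)) Qs
  Ξ-clique []       R _     = sym (ℚP.+-identityʳ _)
  Ξ-clique (q ∷ Qs) R clash = begin
    Ξ (q ∷ Qs ++ R)
      ≡⟨ Ξ-cons q (Qs ++ R) ⟩
    Ξ (Qs ++ R) ℚ.+ w q ℚ.* Ξ (compatibles q (Qs ++ R))
      ≡⟨ cong₂ (λ x y → x ℚ.+ w q ℚ.* Ξ y) (Ξ-clique Qs R (λ m m′ → clash (there m) (there m′)))
               (trans (LP.filter-++ (q #?_) Qs R)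
                      (cong (_++ compatibles q R) (LP.filter-none (q #?_) (All.tabulate (λ m → clash (here refl) (there m)))))) ⟩
    (Ξ R ℚ.+ S) ℚ.+ w q ℚ.* Ξ (compatibles q R)
      ≡⟨ solve 3 (λ a b d → (a :+ b) :+ d := a :+ (d :+ b)) refl (Ξ R) S (w q ℚ.* Ξ (compatibles q R)) ⟩
    Ξ R ℚ.+ (w q ℚ.* Ξ (compatibles q R) ℚ.+ S) ∎
    where
    open ≡-Reasoning
    S = Σ (λ q → w q ℚ.* Ξ (compatibles q R)) Qs

-- The poset [3]^n

≼-refl : x ≼ x
≼-refl = Pointwise.refl ℕP.≤-refl

≼-trans : x ≼ y → y ≼ z → x ≼ z
≼-trans = Pointwise.trans ℕP.≤-trans

rank-mono : x ≼ y → rank x ≤ rank y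
rank-mono []       = z≤n
rank-mono (p ∷ ps) = ℕP.+-mono-≤ p (rank-mono ps)

≼∧rank≡⇒≡ : x ≼ y → rank x ≡ rank y → x ≡ y
≼∧rank≡⇒≡ [] _ = refl
≼∧rank≡⇒≡ {x = a ∷ x} {y = b ∷ y} (a≤b ∷ x≼y) eq with ℕP.m≤n⇒m<n∨m≡n a≤b
... | inj₁ a<b = contradiction eq (ℕP.<⇒≢ (ℕP.+-mono-<-≤ a<b (rank-mono x≼y)))
... | inj₂ a≡b = cong₂ _∷_ (FinP.toℕ-injective a≡b)
                          (≼∧rank≡⇒≡ x≼y (ℕP.+-cancelˡ-≡ (toℕ a) _ _ (trans eq (cong (_+ rank y) (sym a≡b)))))

≼∧≢⇒rank< : x ≼ y → x ≢ y → rank x < rank y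
≼∧≢⇒rank< x≼y x≢y with ℕP.m≤n⇒m<n∨m≡n (rank-mono x≼y)
... | inj₁ lt = lt
... | inj₂ eq = contradiction (≼∧rank≡⇒≡ x≼y eq) x≢y

comparable∧rank≡⇒≡ : Comparable x y → rank x ≡ rank y → x ≡ y
comparable∧rank≡⇒≡ (inj₁ x≼y) eq = ≼∧rank≡⇒≡ x≼y eq
comparable∧rank≡⇒≡ (inj₂ y≼x) eq = sym (≼∧rank≡⇒≡ y≼x (sym eq))

comparable∧rank<⇒≼ : Comparable x y → rank x < rank y → x ≼ y
comparable∧rank<⇒≼ (inj₁ x≼y) _  = x≼y
comparable∧rank<⇒≼ (inj₂ y≼x) lt = contradiction (rank-mono y≼x) (ℕP.<⇒≱ lt)

step-up : x ≼ y → rank x < rank y → ∃[ z ] x ≼ z × z ≼ y × rank z ≡ suc (rank x)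
step-up {x = a ∷ x} {y = b ∷ y} (a≤b ∷ x≼y) lt with ℕP.m≤n⇒m<n∨m≡n a≤b
... | inj₁ a<b = raise a b a<b
  where
  raise : ∀ a b → toℕ a < toℕ b → ∃[ z ] (a ∷ x) ≼ z × z ≼ (b ∷ y) × rank z ≡ suc (rank (a ∷ x))
  raise 0F 1F _ = 1F ∷ x , z≤n ∷ ≼-refl , ℕP.≤-refl ∷ x≼y , refl
  raise 0F 2F _ = 1F ∷ x , z≤n ∷ ≼-refl , s≤s z≤n ∷ x≼y , refl
  raise 1F 2F _ = 2F ∷ x , s≤s z≤n ∷ ≼-refl , ℕP.≤-refl ∷ x≼y , refl
  raise 1F 1F (s≤s ())
  raise 2F 2F (s≤s (s≤s ()))
  raise 2F 1F (s≤s ())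
  raise 1F 0F ()
  raise 2F 0F ()
  raise 0F 0F ()
... | inj₂ a≡b with step-up x≼y (ℕP.+-cancelˡ-< (toℕ a) _ _ (subst (λ t → toℕ a + rank x < t + rank y) (sym a≡b) lt))
...   | z , x≼z , z≼y , rank-z =
  a ∷ z , ℕP.≤-refl ∷ x≼z , a≤b ∷ z≼y , trans (cong (toℕ a +_) rank-z) (ℕP.+-suc _ _)

interpolate : ∀ r → x ≼ y → rank x ≤ r → r ≤ rank y → ∃[ z ] x ≼ z × z ≼ y × rank z ≡ r
interpolate r x≼y x≤r r≤y with ℕP.m≤n⇒∃[o]m+o≡n x≤r
... | d , refl = climb d x≼y r≤y
  where
  climb : ∀ d {x y : Pt n} → x ≼ y → rank x + d ≤ rank y → ∃[ z ] x ≼ z × z ≼ y × rank z ≡ rank x + d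
  climb zero    {x} x≼y _ = x , ≼-refl , x≼y , sym (ℕP.+-identityʳ _)
  climb (suc d) {x} {y} x≼y le with step-up x≼y (ℕP.<-≤-trans (ℕP.m<m+n _ (s≤s z≤n)) le)
  ... | z , x≼z , z≼y , rank-z
    with climb d z≼y (subst (_≤ rank y) (trans (ℕP.+-suc (rank x) d) (cong (_+ d) (sym rank-z))) le)
  ...   | v , z≼v , v≼y , rank-v =
    v , ≼-trans x≼z z≼v , v≼y , trans rank-v (trans (cong (_+ d) rank-z) (sym (ℕP.+-suc _ d)))

private
  top bottom : ∀ n → Pt n
  top n    = Vec.replicate n 2F
  bottom n = Vec.replicate n 0F

  ≼top : ∀ (x : Pt n) → x ≼ top n
  ≼top []      = []
  ≼top (a ∷ x) = FinP.toℕ≤pred[n] a ∷ ≼top x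

  bottom≼ : ∀ (x : Pt n) → bottom n ≼ x
  bottom≼ []      = []
  bottom≼ (a ∷ x) = z≤n ∷ bottom≼ x

  n≤rank-top : ∀ n → n ≤ rank (top n)
  n≤rank-top zero    = z≤n
  n≤rank-top (suc n) = s≤s (ℕP.m≤n⇒m≤1+n (n≤rank-top n))

  rank-bottom : ∀ n → rank (bottom n) ≡ 0
  rank-bottom zero    = refl
  rank-bottom (suc n) = rank-bottom n

exists-above : ∀ {r} (x : Pt n) → rank x ≤ r → r ≤ n → ∃[ v ] x ≼ v × rank v ≡ r
exists-above {n} x x≤r r≤n with interpolate _ (≼top x) x≤r (ℕP.≤-trans r≤n (n≤rank-top n))
... | v , x≼v , _ , rank-v = v , x≼v , rank-v

exists-below : ∀ {r} (x : Pt n) → r ≤ rank x → ∃[ v ] v ≼ x × rank v ≡ r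
exists-below {n} x r≤x with interpolate _ (bottom≼ x) (subst (_≤ _) (sym (rank-bottom n)) z≤n) r≤x
... | v , _ , v≼x , rank-v = v , v≼x , rank-v

points-complete : ∀ (v : Pt n) → v ∈ points n
points-complete []      = here refl
points-complete {suc n} (i ∷ v) =
  ∈ₚ.∈-concat⁺′ (∈ₚ.∈-map⁺ (i ∷_) (points-complete v))
                (∈ₚ.∈-map⁺ (λ j → map (j ∷_) (points n)) (∈ₚ.∈-allFin i))

points-unique : ∀ n → Unique (points n)
points-unique zero    = [] ∷ []
points-unique (suc n) =
  Uniqueₚ.concat⁺ (Allₚ.map⁺ {f = row} (All.universal (λ _ → Uniqueₚ.map⁺ VecP.∷-injectiveʳ (points-unique n)) _))
                  (AllPairsₚ.map⁺ {f = row} (AllPairs.map rows-disjoint (Uniqueₚ.allFin⁺ 3)))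
  where
  row : Fin 3 → List (Pt (suc n))
  row i = map (i ∷_) (points n)
  rows-disjoint : ∀ {i j : Fin 3} → i ≢ j → ∀ {v} → v ∈ map (i ∷_) (points n) × v ∈ map (j ∷_) (points n) → ⊥
  rows-disjoint i≢j (v∈i , v∈j) with ∈ₚ.∈-map⁻ _ v∈i | ∈ₚ.∈-map⁻ _ v∈j
  ... | _ , _ , refl | _ , _ , eq = i≢j (VecP.∷-injectiveˡ eq)

sameRank⇒IsAntichain : ∀ {T : List (Pt n)} {r} → Unique T → All (λ x → rank x ≡ r) T → IsAntichain T
sameRank⇒IsAntichain []             []              = []
sameRank⇒IsAntichain (x∉T ∷ T!) (rank-x ∷ ranks) =
  All.zipWith (λ (x≢y , rank-y) x~y → x≢y (comparable∧rank≡⇒≡ x~y (trans rank-x (sym rank-y)))) (x∉T , ranks)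
  ∷ sameRank⇒IsAntichain T! ranks

covers⇒rank : Covers y x → rank y ≡ suc (rank x)
covers⇒rank {y = y} ((x≼y , x≢y) , nothing-between) with step-up x≼y (≼∧≢⇒rank< x≼y x≢y)
... | z , x≼z , z≼y , rank-z with z ≟ᵖ y
...   | yes refl = rank-z
...   | no z≢y   = ⊥-elim (All.lookup nothing-between (points-complete z)
                     ((x≼z , λ x≡z → ℕP.1+n≢n (sym (trans (cong rank x≡z) rank-z))) , z≼y , z≢y))

covers-intro : x ≼ y → rank y ≡ suc (rank x) → Covers y x
covers-intro x≼y rank-y =
  (x≼y , λ x≡y → ℕP.1+n≢n (sym (trans (cong rank x≡y) rank-y))) ,
  All.tabulate (λ _ ((x≼z , x≢z) , (z≼y , z≢y)) →
    ℕP.<-irrefl refl (ℕP.<-≤-trans (≼∧≢⇒rank< x≼z x≢z)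
                                   (ℕP.≤-pred (subst (_ <_) rank-y (≼∧≢⇒rank< z≼y z≢y)))))

covers⇒≼ : Covers y x → x ≼ y
covers⇒≼ = proj₁ ∘ proj₁

HasseAdj⇒rank : HasseAdj x y → rank x ≡ suc (rank y) ⊎ rank y ≡ suc (rank x)
HasseAdj⇒rank (inj₁ x⋗y) = inj₁ (covers⇒rank x⋗y)
HasseAdj⇒rank (inj₂ y⋗x) = inj₂ (covers⇒rank y⋗x)

private
  min₃ max₃ : Fin 3 → Fin 3 → Fin 3
  min₃ a b with a FinP.≤? b
  ... | yes _ = a
  ... | no _  = b
  max₃ a b with a FinP.≤? b
  ... | yes _ = b
  ... | no _  = a

  module _ (a b : Fin 3) where

    min₃≤ˡ : toℕ (min₃ a b) ≤ toℕ a
    min₃≤ˡ with a FinP.≤? b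
    ... | yes _   = ℕP.≤-refl
    ... | no a≰b  = ℕP.<⇒≤ (ℕP.≰⇒> a≰b)

    min₃≤ʳ : toℕ (min₃ a b) ≤ toℕ b
    min₃≤ʳ with a FinP.≤? b
    ... | yes a≤b = a≤b
    ... | no _    = ℕP.≤-refl

    min₃-glb : ∀ (c : Fin 3) → toℕ c ≤ toℕ a → toℕ c ≤ toℕ b → toℕ c ≤ toℕ (min₃ a b)
    min₃-glb c c≤a c≤b with a FinP.≤? b
    ... | yes _ = c≤a
    ... | no _  = c≤b

    ≤max₃ˡ : toℕ a ≤ toℕ (max₃ a b)
    ≤max₃ˡ with a FinP.≤? b
    ... | yes a≤b = a≤b
    ... | no _    = ℕP.≤-refl

    ≤max₃ʳ : toℕ b ≤ toℕ (max₃ a b)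
    ≤max₃ʳ with a FinP.≤? b
    ... | yes _   = ℕP.≤-refl
    ... | no a≰b  = ℕP.<⇒≤ (ℕP.≰⇒> a≰b)

    max₃-lub : ∀ (c : Fin 3) → toℕ a ≤ toℕ c → toℕ b ≤ toℕ c → toℕ (max₃ a b) ≤ toℕ c
    max₃-lub c a≤c b≤c with a FinP.≤? b
    ... | yes _ = b≤c
    ... | no _  = a≤c

    min₃+max₃ : toℕ (min₃ a b) + toℕ (max₃ a b) ≡ toℕ a + toℕ b
    min₃+max₃ with a FinP.≤? b
    ... | yes _ = refl
    ... | no _  = ℕP.+-comm (toℕ b) (toℕ a)

infixl 7 _⊓_
infixl 6 _⊔_

_⊓_ : Pt n → Pt n → Pt n
_⊓_ = Vec.zipWith min₃

_⊔_ : Pt n → Pt n → Pt n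
_⊔_ = Vec.zipWith max₃

⊓-≼ˡ : ∀ (x y : Pt n) → (x ⊓ y) ≼ x
⊓-≼ˡ []      []      = []
⊓-≼ˡ (a ∷ x) (b ∷ y) = min₃≤ˡ a b ∷ ⊓-≼ˡ x y

⊓-≼ʳ : ∀ (x y : Pt n) → (x ⊓ y) ≼ y
⊓-≼ʳ []      []      = []
⊓-≼ʳ (a ∷ x) (b ∷ y) = min₃≤ʳ a b ∷ ⊓-≼ʳ x y

⊓-glb : z ≼ x → z ≼ y → z ≼ (x ⊓ y)
⊓-glb {x = []}    {y = []}    []         []         = []
⊓-glb {x = a ∷ x} {y = b ∷ y} (c≤a ∷ z≼x) (c≤b ∷ z≼y) = min₃-glb a b _ c≤a c≤b ∷ ⊓-glb z≼x z≼y

⊔-≽ˡ : ∀ (x y : Pt n) → x ≼ (x ⊔ y)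
⊔-≽ˡ []      []      = []
⊔-≽ˡ (a ∷ x) (b ∷ y) = ≤max₃ˡ a b ∷ ⊔-≽ˡ x y

⊔-≽ʳ : ∀ (x y : Pt n) → y ≼ (x ⊔ y)
⊔-≽ʳ []      []      = []
⊔-≽ʳ (a ∷ x) (b ∷ y) = ≤max₃ʳ a b ∷ ⊔-≽ʳ x y

⊔-lub : x ≼ z → y ≼ z → (x ⊔ y) ≼ z
⊔-lub {x = []}    {y = []}    []         []         = []
⊔-lub {x = a ∷ x} {y = b ∷ y} (a≤c ∷ x≼z) (b≤c ∷ y≼z) = max₃-lub a b _ a≤c b≤c ∷ ⊔-lub x≼z y≼z

rank-⊓+⊔ : ∀ (x y : Pt n) → rank (x ⊓ y) + rank (x ⊔ y) ≡ rank x + rank y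
rank-⊓+⊔ []      []      = refl
rank-⊓+⊔ (a ∷ x) (b ∷ y) = begin
  (toℕ (min₃ a b) + rank (x ⊓ y)) + (toℕ (max₃ a b) + rank (x ⊔ y)) ≡⟨ +-interchange (toℕ (min₃ a b)) _ _ _ ⟩
  (toℕ (min₃ a b) + toℕ (max₃ a b)) + (rank (x ⊓ y) + rank (x ⊔ y)) ≡⟨ cong₂ _+_ (min₃+max₃ a b) (rank-⊓+⊔ x y) ⟩
  (toℕ a + toℕ b) + (rank x + rank y)                               ≡⟨ +-interchange (toℕ a) (toℕ b) (rank x) (rank y) ⟩
  (toℕ a + rank x) + (toℕ b + rank y)                               ∎
  where
  open ≡-Reasoning
  open import Algebra.Properties.CommutativeSemigroup ℕP.+-commutativeSemigroup
    using () renaming (interchange to +-interchange)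

CommonUpperCover : Pt n → Pt n → Set
CommonUpperCover x y = ∃[ v ] x ≼ v × y ≼ v × rank v ≡ suc (rank x)

CommonLowerCover : Pt n → Pt n → Set
CommonLowerCover x y = ∃[ v ] v ≼ x × v ≼ y × rank x ≡ suc (rank v)

-- Both use the modularity rank (x ⊓ y) + rank (x ⊔ y) = rank x + rank y.
lower⇒upper : rank x ≡ rank y → x ≢ y → CommonLowerCover x y → CommonUpperCover x y
lower⇒upper {x = x} {y = y} x~y x≢y (z , z≼x , z≼y , rank-x) = x ⊔ y , ⊔-≽ˡ x y , ⊔-≽ʳ x y , rank-⊔
  where
  x⊓y≢x : x ⊓ y ≢ x
  x⊓y≢x eq = x≢y (≼∧rank≡⇒≡ (subst (_≼ y) eq (⊓-≼ʳ x y)) x~y)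
  rank-⊓ : rank (x ⊓ y) ≡ rank z
  rank-⊓ = ℕP.≤-antisym (ℕP.≤-pred (subst (rank (x ⊓ y) <_) rank-x (≼∧≢⇒rank< (⊓-≼ˡ x y) x⊓y≢x)))
                        (rank-mono (⊓-glb z≼x z≼y))
  rank-⊔ : rank (x ⊔ y) ≡ suc (rank x)
  rank-⊔ = ℕP.+-cancelˡ-≡ (rank z) _ _ (begin
    rank z + rank (x ⊔ y)        ≡⟨ cong (_+ rank (x ⊔ y)) rank-⊓ ⟨
    rank (x ⊓ y) + rank (x ⊔ y)  ≡⟨ rank-⊓+⊔ x y ⟩
    rank x + rank y              ≡⟨ cong₂ _+_ rank-x (sym x~y) ⟩
    suc (rank z) + rank x        ≡⟨ ℕP.+-suc (rank z) (rank x) ⟨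
    rank z + suc (rank x)        ∎)
    where open ≡-Reasoning

upper⇒lower : rank x ≡ rank y → x ≢ y → CommonUpperCover x y → CommonLowerCover x y
upper⇒lower {x = x} {y = y} x~y x≢y (v , x≼v , y≼v , rank-v) = x ⊓ y , ⊓-≼ˡ x y , ⊓-≼ʳ x y , rank-⊓
  where
  x≢x⊔y : x ≢ x ⊔ y
  x≢x⊔y eq = x≢y (sym (≼∧rank≡⇒≡ (subst (y ≼_) (sym eq) (⊔-≽ʳ x y)) (sym x~y)))
  rank-⊔ : rank (x ⊔ y) ≡ suc (rank x)
  rank-⊔ = ℕP.≤-antisym (subst (rank (x ⊔ y) ≤_) rank-v (rank-mono (⊔-lub x≼v y≼v)))
                        (≼∧≢⇒rank< (⊔-≽ˡ x y) x≢x⊔y)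
  rank-⊓ : rank x ≡ suc (rank (x ⊓ y))
  rank-⊓ = ℕP.+-cancelʳ-≡ (rank x) _ _ (begin
    rank x + rank x                  ≡⟨ cong (rank x +_) x~y ⟩
    rank x + rank y                  ≡⟨ rank-⊓+⊔ x y ⟨
    rank (x ⊓ y) + rank (x ⊔ y)      ≡⟨ cong (rank (x ⊓ y) +_) rank-⊔ ⟩
    rank (x ⊓ y) + suc (rank x)      ≡⟨ ℕP.+-suc _ _ ⟩
    suc (rank (x ⊓ y)) + rank x      ∎)
    where open ≡-Reasoning

upper⇒Dist≤2 : rank x ≡ rank y → CommonUpperCover x y → Dist≤2 x y
upper⇒Dist≤2 x~y (v , x≼v , y≼v , rank-v) =
  inj₂ (inj₂ (lose (points-complete v)
    (inj₂ (covers-intro x≼v rank-v) , inj₁ (covers-intro y≼v (trans rank-v (cong suc x~y))))))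

lower⇒Dist≤2 : rank x ≡ rank y → CommonLowerCover x y → Dist≤2 x y
lower⇒Dist≤2 x~y (z , z≼x , z≼y , rank-x) =
  inj₂ (inj₂ (lose (points-complete z)
    (inj₁ (covers-intro z≼x rank-x) , inj₂ (covers-intro z≼y (trans (sym x~y) rank-x)))))

Dist≤2-sameRank : rank x ≡ rank y → Dist≤2 x y → x ≡ y ⊎ CommonUpperCover x y ⊎ CommonLowerCover x y
Dist≤2-sameRank x~y (inj₁ x≡y) = inj₁ x≡y
Dist≤2-sameRank x~y (inj₂ (inj₁ adj)) with HasseAdj⇒rank adj
... | inj₁ eq = contradiction (trans (sym eq) x~y) ℕP.1+n≢n
... | inj₂ eq = contradiction (trans (sym eq) (sym x~y)) ℕP.1+n≢n
Dist≤2-sameRank x~y (inj₂ (inj₂ path)) with find path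
... | z , _ , inj₂ z⋗x , inj₁ z⋗y = inj₂ (inj₁ (z , covers⇒≼ z⋗x , covers⇒≼ z⋗y , covers⇒rank z⋗x))
... | z , _ , inj₁ x⋗z , inj₂ y⋗z = inj₂ (inj₂ (z , covers⇒≼ x⋗z , covers⇒≼ y⋗z , covers⇒rank x⋗z))
... | z , _ , inj₁ x⋗z , inj₁ z⋗y =
  contradiction (trans (sym (trans (covers⇒rank x⋗z) (cong suc (covers⇒rank z⋗y)))) x~y) (ℕP.m+1+n≢n 1)
... | z , _ , inj₂ z⋗x , inj₂ y⋗z =
  contradiction (trans (sym (trans (covers⇒rank y⋗z) (cong suc (covers⇒rank z⋗x)))) (sym x~y)) (ℕP.m+1+n≢n 1)

-- The middle levels

module Middle (n : ℕ) where

  Lₙ₋₁ Lₙ Lₙ₊₁ : List (Pt n)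
  Lₙ₋₁ = levelN-1 n
  Lₙ   = levelN n
  Lₙ₊₁ = levelN+1 n

  InLₙ₋₁ InLₙ₊₁ : Pt n → Set
  InLₙ₋₁ x = suc (rank x) ≡ n
  InLₙ₊₁ x = rank x ≡ suc n

  ∈Lₙ⁺ : rank x ≡ n → x ∈ Lₙ
  ∈Lₙ⁺ {x} = ∈ₚ.∈-filter⁺ (λ v → rank v ℕ.≟ n) (points-complete x)

  ∈Lₙ⁻ : x ∈ Lₙ → rank x ≡ n
  ∈Lₙ⁻ = proj₂ ∘ ∈ₚ.∈-filter⁻ (λ v → rank v ℕ.≟ n) {xs = points n}

  ∈Lₙ₋₁⁻ : x ∈ Lₙ₋₁ → InLₙ₋₁ x
  ∈Lₙ₋₁⁻ = proj₂ ∘ ∈ₚ.∈-filter⁻ (λ v → suc (rank v) ℕ.≟ n) {xs = points n}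

  ∈Lₙ₊₁⁻ : x ∈ Lₙ₊₁ → InLₙ₊₁ x
  ∈Lₙ₊₁⁻ = proj₂ ∘ ∈ₚ.∈-filter⁻ (λ v → rank v ℕ.≟ suc n) {xs = points n}

  Lₙ₋₁-unique : Unique Lₙ₋₁
  Lₙ₋₁-unique = Uniqueₚ.filter⁺ _ (points-unique n)

  Lₙ-unique : Unique Lₙ
  Lₙ-unique = Uniqueₚ.filter⁺ _ (points-unique n)

  Lₙ₊₁-unique : Unique Lₙ₊₁
  Lₙ₊₁-unique = Uniqueₚ.filter⁺ _ (points-unique n)

  -- ∂{x} and ∂{y} intersect.
  Touch : Pt n → Pt n → Set
  Touch x y = Any (λ v → Comparable v x × Comparable v y) Lₙ

  touch? : ∀ x y → Dec (Touch x y)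
  touch? x y = any? (λ v → comparable? v x ×-dec comparable? v y) Lₙ

  Touch-sym : Touch x y → Touch y x
  Touch-sym = Any.map Data.Product.swap

  Avoids : List (Pt n) → Pt n → Set
  Avoids A y = ¬ Any (λ a → Touch a y) A

  avoids? : ∀ A y → Dec (Avoids A y)
  avoids? A y = ¬? (any? (λ a → touch? a y) A)

  avoiding : List (Pt n) → List (Pt n) → List (Pt n)
  avoiding A = filter (avoids? A)

  record Layer (I : Pt n → Set) : Set where
    field
      touch-refl   : I x → Touch x x
      Dist≤2⇒Touch : I x → I y → Dist≤2 x y → Touch x y
      Touch⇒Dist≤2 : I x → I y → Touch x y → Dist≤2 x y

  private
    below-Lₙ : ∀ {v} → InLₙ₋₁ x → v ∈ Lₙ → Comparable v x → x ≼ v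
    below-Lₙ x∈ v∈ c = comparable∧rank<⇒≼ (Sum.swap c) (subst (_ <_) (trans x∈ (sym (∈Lₙ⁻ v∈))) ℕP.≤-refl)

    above-Lₙ : ∀ {v} → InLₙ₊₁ x → v ∈ Lₙ → Comparable v x → v ≼ x
    above-Lₙ x∈ v∈ c = comparable∧rank<⇒≼ c (subst (_< _) (sym (∈Lₙ⁻ v∈)) (subst (n <_) (sym x∈) ℕP.≤-refl))

    Touch⇒upper : InLₙ₋₁ x → InLₙ₋₁ y → Touch x y → CommonUpperCover x y
    Touch⇒upper x∈ y∈ t with find t
    ... | v , v∈ , cx , cy = v , below-Lₙ x∈ v∈ cx , below-Lₙ y∈ v∈ cy , trans (∈Lₙ⁻ v∈) (sym x∈)

    upper⇒Touch : InLₙ₋₁ x → CommonUpperCover x y → Touch x y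
    upper⇒Touch x∈ (v , x≼v , y≼v , rank-v) = lose (∈Lₙ⁺ (trans rank-v x∈)) (inj₂ x≼v , inj₂ y≼v)

    Touch⇒lower : InLₙ₊₁ x → InLₙ₊₁ y → Touch x y → CommonLowerCover x y
    Touch⇒lower x∈ y∈ t with find t
    ... | v , v∈ , cx , cy = v , above-Lₙ x∈ v∈ cx , above-Lₙ y∈ v∈ cy , trans x∈ (cong suc (sym (∈Lₙ⁻ v∈)))

    lower⇒Touch : InLₙ₊₁ x → CommonLowerCover x y → Touch x y
    lower⇒Touch x∈ (v , v≼x , v≼y , rank-x) =
      lose (∈Lₙ⁺ (ℕP.suc-injective (trans (sym rank-x) x∈))) (inj₁ v≼x , inj₁ v≼y)

  layerₙ₋₁ : Layer InLₙ₋₁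
  layerₙ₋₁ = record { touch-refl = touch-refl ; Dist≤2⇒Touch = dist⇒touch ; Touch⇒Dist≤2 = touch⇒dist }
    where
    same : InLₙ₋₁ x → InLₙ₋₁ y → rank x ≡ rank y
    same x∈ y∈ = ℕP.suc-injective (trans x∈ (sym y∈))
    touch-refl : InLₙ₋₁ x → Touch x x
    touch-refl {x} x∈ with exists-above x (subst (rank x ≤_) x∈ (ℕP.n≤1+n _)) ℕP.≤-refl
    ... | v , x≼v , rank-v = upper⇒Touch x∈ (v , x≼v , x≼v , trans rank-v (sym x∈))
    dist⇒touch : InLₙ₋₁ x → InLₙ₋₁ y → Dist≤2 x y → Touch x y
    dist⇒touch {x} {y} x∈ y∈ d with Dist≤2-sameRank (same {x} {y} x∈ y∈) d
    ... | inj₁ refl       = touch-refl x∈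
    ... | inj₂ (inj₁ up)  = upper⇒Touch x∈ up
    ... | inj₂ (inj₂ low) with x ≟ᵖ y
    ...   | yes refl = touch-refl x∈
    ...   | no x≢y   = upper⇒Touch x∈ (lower⇒upper (same {x} {y} x∈ y∈) x≢y low)
    touch⇒dist : InLₙ₋₁ x → InLₙ₋₁ y → Touch x y → Dist≤2 x y
    touch⇒dist {x} {y} x∈ y∈ t = upper⇒Dist≤2 (same {x} {y} x∈ y∈) (Touch⇒upper x∈ y∈ t)

  layerₙ₊₁ : Layer InLₙ₊₁
  layerₙ₊₁ = record { touch-refl = touch-refl ; Dist≤2⇒Touch = dist⇒touch ; Touch⇒Dist≤2 = touch⇒dist }
    where
    same : InLₙ₊₁ x → InLₙ₊₁ y → rank x ≡ rank y
    same x∈ y∈ = trans x∈ (sym y∈)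
    touch-refl : InLₙ₊₁ x → Touch x x
    touch-refl {x} x∈ with exists-below x (subst (n ≤_) (sym x∈) (ℕP.n≤1+n n))
    ... | v , v≼x , rank-v = lower⇒Touch x∈ (v , v≼x , v≼x , trans x∈ (cong suc (sym rank-v)))
    dist⇒touch : InLₙ₊₁ x → InLₙ₊₁ y → Dist≤2 x y → Touch x y
    dist⇒touch {x} {y} x∈ y∈ d with Dist≤2-sameRank (same {x} {y} x∈ y∈) d
    ... | inj₁ refl       = touch-refl x∈
    ... | inj₂ (inj₂ low) = lower⇒Touch x∈ low
    ... | inj₂ (inj₁ up) with x ≟ᵖ y
    ...   | yes refl = touch-refl x∈
    ...   | no x≢y   = lower⇒Touch x∈ (upper⇒lower (same {x} {y} x∈ y∈) x≢y up)
    touch⇒dist : InLₙ₊₁ x → InLₙ₊₁ y → Touch x y → Dist≤2 x y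
    touch⇒dist {x} {y} x∈ y∈ t = lower⇒Dist≤2 (same {x} {y} x∈ y∈) (Touch⇒lower x∈ y∈ t)

  Comparable⇒Touch : InLₙ₋₁ x → InLₙ₊₁ y → Comparable x y → Touch x y
  Comparable⇒Touch {x} {y} x∈ y∈ c with interpolate n (comparable∧rank<⇒≼ c rank<) x≤n n≤y
    where
    x≤n : rank x ≤ n
    x≤n = subst (rank x ≤_) x∈ (ℕP.n≤1+n _)
    n≤y : n ≤ rank y
    n≤y = subst (n ≤_) (sym y∈) (ℕP.n≤1+n n)
    rank< : rank x < rank y
    rank< = subst (_≤ rank y) (sym x∈) n≤y
  ... | v , x≼v , v≼y , rank-v = lose (∈Lₙ⁺ rank-v) (inj₂ x≼v , inj₁ v≼y)

  Touch⇒Comparable : InLₙ₋₁ x → InLₙ₊₁ y → Touch x y → Comparable x y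
  Touch⇒Comparable x∈ y∈ t with find t
  ... | v , v∈ , cx , cy = inj₁ (≼-trans (below-Lₙ x∈ v∈ cx) (above-Lₙ y∈ v∈ cy))

  ∂-∈⁻ : ∀ {A v} → v ∈ ∂ A → v ∈ Lₙ × Any (Comparable v) A
  ∂-∈⁻ {A} = ∈ₚ.∈-filter⁻ (λ v → any? (comparable? v) A) {xs = Lₙ}

  ∂-∈⁺ : ∀ {A v} → v ∈ Lₙ → Any (Comparable v) A → v ∈ ∂ A
  ∂-∈⁺ {A} = ∈ₚ.∈-filter⁺ (λ v → any? (comparable? v) A) {xs = Lₙ}

  ∂-cong : ∀ {A B : List (Pt n)} → A ⊆ B → B ⊆ A → ∂ A ≡ ∂ B
  ∂-cong {A} {B} A⊆B B⊆A = filter-cong-∈ (λ v → any? (comparable? v) A) (λ v → any? (comparable? v) B) Lₙ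
    (λ _ → Any-resp-⊆ A⊆B , Any-resp-⊆ B⊆A)

  wC-cong : ∀ {A B : List (Pt n)} → A ⊆ B → B ⊆ A → wC A ≡ wC B
  wC-cong A⊆B B⊆A = cong (pow½ ∘ length) (∂-cong A⊆B B⊆A)

  wC-[] : wC {n} [] ≡ 1ℚ
  wC-[] = cong (pow½ ∘ length) (LP.filter-none (λ v → any? (comparable? v) []) (All.universal (λ _ ()) Lₙ))

  -- T avoiding S says exactly that ∂ S and ∂ T are disjoint.
  length-∂-++ : ∀ S T → All (Avoids S) T → length (∂ (S ++ T)) ≡ length (∂ S) + length (∂ T)
  length-∂-++ S T S⊥T = trans
    (cong length (filter-cong-∈ (λ v → any? (comparable? v) (S ++ T))
                                (λ v → any? (comparable? v) S ⊎-dec any? (comparable? v) T)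
                                Lₙ (λ _ → Anyₚ.++⁻ S , Sum.[ Anyₚ.++⁺ˡ , Anyₚ.++⁺ʳ S ])))
    (length-filter-⊎ (λ v → any? (comparable? v) S) (λ v → any? (comparable? v) T) Lₙ disjoint)
    where
    disjoint : ∀ {v} → v ∈ Lₙ → Any (Comparable v) S → Any (Comparable v) T → ⊥
    disjoint v∈ aS aT with find aS | find aT
    ... | a , a∈ , ca | b , b∈ , cb = All.lookup S⊥T b∈ (lose a∈ (lose v∈ (ca , cb)))

  wC-++ : ∀ S T → All (Avoids S) T → wC (S ++ T) ≡ wC S ℚ.* wC T
  wC-++ S T S⊥T = trans (cong pow½ (length-∂-++ S T S⊥T)) (pow½-+ (length (∂ S)) (length (∂ T)))

  Compatible⇒Avoids : ∀ {A B : List (Pt n)} → Compatible A B → All (Avoids A) B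
  Compatible⇒Avoids c = All.tabulate λ b∈ ta →
    let a , a∈ , t = find ta ; v , v∈ , ca , cb = find t
    in All.lookup c (∂-∈⁺ v∈ (lose a∈ ca)) (∂-∈⁺ v∈ (lose b∈ cb))

  Avoids⇒Compatible : ∀ {A B : List (Pt n)} → All (Avoids A) B → Compatible A B
  Avoids⇒Compatible {A} {B} A⊥B = All.tabulate λ v∈∂A v∈∂B →
    let v∈ , aA = ∂-∈⁻ {A} v∈∂A ; _ , aB = ∂-∈⁻ {B} v∈∂B ; a , a∈ , ca = find aA ; b , b∈ , cb = find aB
    in All.lookup A⊥B b∈ (lose a∈ (lose v∈ (ca , cb)))

  Compatible-sym : ∀ {A B : List (Pt n)} → Compatible A B → Compatible B A
  Compatible-sym c = All.tabulate λ v∈∂B v∈∂A → All.lookup c v∈∂A v∈∂B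

  Avoids-sym : ∀ {A B : List (Pt n)} → All (Avoids A) B → All (Avoids B) A
  Avoids-sym A⊥B = All.tabulate λ a∈ tb → let b , b∈ , t = find tb in All.lookup A⊥B b∈ (lose a∈ (Touch-sym t))

  Avoids-⊆ : ∀ {A B : List (Pt n)} {y} → A ⊆ B → Avoids B y → Avoids A y
  Avoids-⊆ A⊆B B⊥y = B⊥y ∘ Any-resp-⊆ A⊆B

  Avoids-++⁻ : ∀ A B {y} → Avoids (A ++ B) y → Avoids A y × Avoids B y
  Avoids-++⁻ A B A++B⊥y = A++B⊥y ∘ Anyₚ.++⁺ˡ , A++B⊥y ∘ Anyₚ.++⁺ʳ A

  Avoids-++⁺ : ∀ A B {y} → Avoids A y → Avoids B y → Avoids (A ++ B) y
  Avoids-++⁺ A B A⊥y B⊥y = Sum.[ A⊥y , B⊥y ] ∘ Anyₚ.++⁻ A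

  All-Avoids-++⁻ : ∀ A B {T} → All (Avoids (A ++ B)) T → All (Avoids A) T × All (Avoids B) T
  All-Avoids-++⁻ A B A++B⊥T = All.map (proj₁ ∘ Avoids-++⁻ A B) A++B⊥T , All.map (proj₂ ∘ Avoids-++⁻ A B) A++B⊥T

  All-Avoids-++⁺ : ∀ A B {T} → All (Avoids A) T × All (Avoids B) T → All (Avoids (A ++ B)) T
  All-Avoids-++⁺ A B = All.zipWith (λ (A⊥y , B⊥y) → Avoids-++⁺ A B A⊥y B⊥y)

  ∈-subsets-avoiding : ∀ {A} V {T} → T ∈ subsets (avoiding A V) → All (Avoids A) T
  ∈-subsets-avoiding {A} V T∈ =
    All.tabulate λ y∈T → proj₂ (∈ₚ.∈-filter⁻ (avoids? A) {xs = V} (∈-subsets⇒⊆ T∈ y∈T))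

-- 2-linked components

module Linking (n : ℕ) where

  open Middle n

  private variable
    V V′ : List (Pt n)

  reach-suc⁻ : y ∈ reach V x (suc k) → y ∈ V × (y ∈ reach V x k ⊎ Any (λ z → Dist≤2 z y) (reach V x k))
  reach-suc⁻ {V = V} {x = x} {k = k} =
    ∈ₚ.∈-filter⁻ (λ y → (y ∈? reach V x k) ⊎-dec any? (λ z → dist≤2? z y) (reach V x k)) {xs = V}

  reach-suc⁺ : y ∈ V → y ∈ reach V x k ⊎ Any (λ z → Dist≤2 z y) (reach V x k) → y ∈ reach V x (suc k)
  reach-suc⁺ {V = V} {x = x} {k = k} =
    ∈ₚ.∈-filter⁺ (λ y → (y ∈? reach V x k) ⊎-dec any? (λ z → dist≤2? z y) (reach V x k)) {xs = V}

  reach⊆ : x ∈ V → reach V x k ⊆ V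
  reach⊆ {k = zero}  x∈V (here refl) = x∈V
  reach⊆ {k = suc k} x∈V y∈         = proj₁ (reach-suc⁻ {k = k} y∈)

  reach-edge : z ∈ reach V x k → y ∈ V → Dist≤2 z y → y ∈ reach V x (suc k)
  reach-edge {k = k} z∈ y∈V d = reach-suc⁺ {k = k} y∈V (inj₂ (lose z∈ d))

  reach-suc : x ∈ V → reach V x k ⊆ reach V x (suc k)
  reach-suc {k = k} x∈V y∈ = reach-suc⁺ {k = k} (reach⊆ {k = k} x∈V y∈) (inj₁ y∈)

  reach-mono : ∀ {V x y j k} → x ∈ V → j ≤ k → y ∈ reach V x j → y ∈ reach V x k
  reach-mono {V} {x} {y} {j} x∈V j≤k y∈ with ℕP.m≤n⇒∃[o]m+o≡n j≤k
  ... | d , refl = go d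
    where
    go : ∀ d → y ∈ reach V x (j + d)
    go zero    = subst (λ i → y ∈ reach V x i) (sym (ℕP.+-identityʳ j)) y∈
    go (suc d) = subst (λ i → y ∈ reach V x i) (sym (ℕP.+-suc j d)) (reach-suc {k = j + d} x∈V (go d))

  reach-⊆ : V ⊆ V′ → reach V x k ⊆ reach V′ x k
  reach-⊆ {k = zero}  V⊆V′ y∈ = y∈
  reach-⊆ {k = suc k} V⊆V′ y∈ with reach-suc⁻ {k = k} y∈
  ... | y∈V , inj₁ y∈R = reach-suc⁺ {k = k} (V⊆V′ y∈V) (inj₁ (reach-⊆ {k = k} V⊆V′ y∈R))
  ... | y∈V , inj₂ e with find e
  ...   | z , z∈R , d = reach-edge {k = k} (reach-⊆ {k = k} V⊆V′ z∈R) (V⊆V′ y∈V) d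

  reach-trans : ∀ {V x y z} j k → x ∈ V → z ∈ reach V x j → y ∈ reach V z k → y ∈ reach V x (j + k)
  reach-trans {V} {x} {y} j zero x∈V z∈ (here refl) =
    subst (λ i → y ∈ reach V x i) (sym (ℕP.+-identityʳ j)) z∈
  reach-trans {V} {x} {y} j (suc k) x∈V z∈ y∈ =
    subst (λ i → y ∈ reach V x i) (sym (ℕP.+-suc j k)) (step (reach-suc⁻ {k = k} y∈))
    where
    step : y ∈ V × (y ∈ reach V _ k ⊎ Any (λ w → Dist≤2 w y) (reach V _ k)) → y ∈ reach V x (suc (j + k))
    step (_ , inj₁ y∈R) = reach-suc {k = j + k} x∈V (reach-trans j k x∈V z∈ y∈R)
    step (y∈V , inj₂ e) = let w , w∈R , d = find e in reach-edge {k = j + k} (reach-trans j k x∈V z∈ w∈R) y∈V d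

  reach-closed : ∀ (P : Pt n → Set) → P x → (∀ {z y} → P z → y ∈ V → Dist≤2 z y → P y) →
                 ∀ k {y} → y ∈ reach V x k → P y
  reach-closed P px closed zero    (here refl) = px
  reach-closed P px closed (suc k) y∈ with reach-suc⁻ {k = k} y∈
  ... | _ , inj₁ y∈R = reach-closed P px closed k y∈R
  ... | y∈V , inj₂ e with find e
  ...   | z , z∈R , d = closed (reach-closed P px closed k z∈R) y∈V d

  TwoLinked⁻ : TwoLinked V → x ∈ V → y ∈ V → y ∈ reach V x (length V)
  TwoLinked⁻ linked x∈V y∈V = All.lookup (All.lookup linked x∈V) y∈V

  TwoLinked⁺ : (∀ {x y} → x ∈ V → y ∈ V → y ∈ reach V x (length V)) → TwoLinked V
  TwoLinked⁺ linked = All.tabulate λ x∈V → All.tabulate λ y∈V → linked x∈V y∈V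

  TwoLinked-[_] : ∀ u → TwoLinked (u ∷ [])
  TwoLinked-[ u ] = TwoLinked⁺ λ { (here refl) (here refl) → reach-suc {k = 0} (here refl) (here refl) }

  module _ {I : Pt n → Set} (layer : Layer I) where

    open Layer layer

    TwoLinked-extend : ∀ {A A′ s} → (∀ {y} → y ∈ A′ → I y) → A ⊆ A′ → s ∈ A′ →
                       (∀ {y} → y ∈ A′ → y ∈ A ⊎ y ≡ s) → length A < length A′ →
                       TwoLinked A → Any (λ a → Touch a s) A → TwoLinked A′
    TwoLinked-extend {A} {A′} {s} I-A′ A⊆A′ s∈A′ new |A|<|A′| linked touch = TwoLinked⁺ reach′
      where
      a = proj₁ (find touch)
      a∈A = proj₁ (proj₂ (find touch))
      a~s : Dist≤2 a s
      a~s = Touch⇒Dist≤2 (I-A′ (A⊆A′ a∈A)) (I-A′ s∈A′) (proj₂ (proj₂ (find touch)))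
      s~a : Dist≤2 s a
      s~a = Touch⇒Dist≤2 (I-A′ s∈A′) (I-A′ (A⊆A′ a∈A)) (Touch-sym (proj₂ (proj₂ (find touch))))
      old : ∀ {x y} → x ∈ A → y ∈ A → y ∈ reach A′ x (length A)
      old x∈A y∈A = reach-⊆ {k = length A} A⊆A′ (TwoLinked⁻ linked x∈A y∈A)
      reach′ : ∀ {x y} → x ∈ A′ → y ∈ A′ → y ∈ reach A′ x (length A′)
      reach′ {x} {y} x∈A′ y∈A′ with new x∈A′ | new y∈A′
      ... | inj₁ x∈A | inj₁ y∈A = reach-mono x∈A′ (ℕP.<⇒≤ |A|<|A′|) (old x∈A y∈A)
      ... | inj₁ x∈A | inj₂ refl = reach-mono x∈A′ |A|<|A′| (reach-edge {k = length A} (old x∈A a∈A) s∈A′ a~s)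
      ... | inj₂ refl | inj₁ y∈A =
        reach-mono x∈A′ |A|<|A′|
          (reach-trans 1 (length A) x∈A′ (reach-edge {k = 0} (here refl) (A⊆A′ a∈A) s~a) (old a∈A y∈A))
      ... | inj₂ refl | inj₂ refl = reach-mono {k = length A′} x∈A′ z≤n (here refl)

    module Component {u : Pt n} {S : List (Pt n)} (I-u : I u) (I-S : All I S) (S! : Unique S) (u∉S : u ∉ S) where

      open Difference (_≟ᵖ_ {n})

      IsComponent : List (Pt n) → Set
      IsComponent C = IsPolymerCand (u ∷ C) × All (Avoids (u ∷ C)) (S ∖ C)

      isComponent? : ∀ C → Dec (IsComponent C)
      isComponent? C = isPolymerCand? (u ∷ C) ×-dec all? (avoids? (u ∷ C)) (S ∖ C)

      private
        I-∷ : ∀ {C y} → C ∈ subsets S → y ∈ u ∷ C → I y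
        I-∷ C∈ (here refl)  = I-u
        I-∷ C∈ (there y∈C) = All.lookup I-S (∈-subsets⇒⊆ C∈ y∈C)

        ∈-∖⁺ : ∀ {C y} → y ∈ S → y ∉ C → y ∈ S ∖ C
        ∈-∖⁺ {C} = ∈ₚ.∈-filter⁺ (λ y → ¬? (y ∈? C)) {xs = S}

        ∈-∖⁻ : ∀ {C y} → y ∈ S ∖ C → y ∈ S × y ∉ C
        ∈-∖⁻ {C} = ∈ₚ.∈-filter⁻ (λ y → ¬? (y ∈? C)) {xs = S}

      -- Everything 2-linked to u inside u ∷ C₁ stays in u ∷ C₂, since nothing of S ∖ C₂ touches u ∷ C₂.
      component-⊆ : ∀ {C₁ C₂} → C₁ ∈ subsets S → C₂ ∈ subsets S →
                    IsComponent C₁ → IsComponent C₂ → C₁ ⊆ C₂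
      component-⊆ {C₁} {C₂} C₁∈ C₂∈ ((_ , linked₁) , _) (_ , isolated₂) {c} c∈C₁
        with reach-closed {V = u ∷ C₁} (_∈ u ∷ C₂) (here refl) closed (length (u ∷ C₁))
                          (TwoLinked⁻ linked₁ (here refl) (there c∈C₁))
        where
        closed : ∀ {z y} → z ∈ u ∷ C₂ → y ∈ u ∷ C₁ → Dist≤2 z y → y ∈ u ∷ C₂
        closed {z} {y} z∈ y∈ z~y with y ∈? (u ∷ C₂) | y∈
        ... | yes y∈C₂ | _           = y∈C₂
        ... | no y∉C₂  | here refl   = ⊥-elim (y∉C₂ (here refl))
        ... | no y∉C₂  | there y∈C₁ =
          ⊥-elim (All.lookup isolated₂ (∈-∖⁺ y∈S (y∉C₂ ∘ there))
                             (lose z∈ (Dist≤2⇒Touch (I-∷ C₂∈ z∈) (All.lookup I-S y∈S) z~y)))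
          where y∈S = ∈-subsets⇒⊆ C₁∈ y∈C₁
      ... | here refl   = ⊥-elim (u∉S (∈-subsets⇒⊆ C₁∈ c∈C₁))
      ... | there c∈C₂ = c∈C₂

      component-unique : ∀ {C₁ C₂} → C₁ ∈ subsets S → C₂ ∈ subsets S →
                         IsComponent C₁ → IsComponent C₂ → C₁ ≡ C₂
      component-unique C₁∈ C₂∈ comp₁ comp₂ =
        subsets-ext S! C₁∈ C₂∈ (component-⊆ C₁∈ C₂∈ comp₁ comp₂) (component-⊆ C₂∈ C₁∈ comp₂ comp₁)

      private
        grow : ∀ {C s} → C ∈ subsets S → TwoLinked (u ∷ C) → s ∈ S ∖ C → Any (λ a → Touch a s) (u ∷ C) →
               ∃[ C′ ] C′ ∈ subsets S × TwoLinked (u ∷ C′) × length C < length C′ × length C′ ≤ length S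
        grow {C} {s} C∈ linked s∈ touch =
          C′ , filter∈subsets C′? S , linked′ , longer , LP.length-filter C′? S
          where
          C′? = λ y → (y ∈? C) ⊎-dec (y ≟ᵖ s)
          C′  = filter C′? S
          s∈S = proj₁ (∈-∖⁻ s∈)
          longer : length C < length C′
          longer = subst (λ L → length L < length C′) (sym (∈-subsets⇒≡filter S! C∈))
                         (length-filter-< (_∈? C) C′? inj₁ s∈S (inj₂ refl) (proj₂ (∈-∖⁻ s∈)))
          kept : ∀ {y} → y ∈ u ∷ C → y ∈ u ∷ C′
          kept (here refl)  = here refl
          kept (there y∈C) = there (∈ₚ.∈-filter⁺ C′? {xs = S} (∈-subsets⇒⊆ C∈ y∈C) (inj₁ y∈C))
          new : ∀ {y} → y ∈ u ∷ C′ → y ∈ u ∷ C ⊎ y ≡ s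
          new (here refl)  = inj₁ (here refl)
          new (there y∈C′) with proj₂ (∈ₚ.∈-filter⁻ C′? {xs = S} y∈C′)
          ... | inj₁ y∈C = inj₁ (there y∈C)
          ... | inj₂ y≡s = inj₂ y≡s
          linked′ : TwoLinked (u ∷ C′)
          linked′ = TwoLinked-extend (I-∷ (filter∈subsets C′? S)) kept
                                     (there (∈ₚ.∈-filter⁺ C′? {xs = S} s∈S (inj₂ refl))) new (s≤s longer) linked touch

        grow-or-stop : ∀ {C} → C ∈ subsets S → TwoLinked (u ∷ C) → IsComponent C ⊎
                       ∃[ C′ ] C′ ∈ subsets S × TwoLinked (u ∷ C′) × length C < length C′ × length C′ ≤ length S
        grow-or-stop {C} C∈ linked with all? (avoids? (u ∷ C)) (S ∖ C)
        ... | yes isolated = inj₁ ((s≤s z≤n , linked) , isolated)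
        ... | no ¬isolated with find (Allₚ.¬All⇒Any¬ (avoids? (u ∷ C)) (S ∖ C) ¬isolated)
        ...   | s , s∈ , ¬avoids =
          inj₂ (grow C∈ linked s∈ (decidable-stable (any? (λ a → touch? a s) (u ∷ C)) ¬avoids))

        build : ∀ k {C} → C ∈ subsets S → TwoLinked (u ∷ C) → length S ≤ length C + k →
                ∃[ C* ] C* ∈ subsets S × IsComponent C*
        build k {C} C∈ linked bound with grow-or-stop C∈ linked
        ... | inj₁ component = C , C∈ , component
        build zero {C} C∈ linked bound | inj₂ (C′ , C′∈ , linked′ , longer , C′≤S) =
          ⊥-elim (ℕP.<-irrefl refl
            (ℕP.<-≤-trans longer (ℕP.≤-trans C′≤S (subst (length S ≤_) (ℕP.+-identityʳ _) bound))))
        build (suc k) {C} C∈ linked bound | inj₂ (C′ , C′∈ , linked′ , longer , C′≤S) =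
          build k C′∈ linked′
            (ℕP.≤-trans bound (subst (_≤ length C′ + k) (sym (ℕP.+-suc (length C) k)) (ℕP.+-monoˡ-≤ k longer)))

      component-exists : ∃[ C ] C ∈ subsets S × IsComponent C
      component-exists = build (length S) ([]∈subsets S) TwoLinked-[ u ] ℕP.≤-refl

    -- Every S ⊆ V splits uniquely as C ⊎ R with u ∷ C the polymer of u in u ∷ S and R avoiding it.
    Σ-by-component : ∀ {u V} → I u → All I V → Unique V → u ∉ V → (g : List (Pt n) → ℚ) →
      (∀ {A B} → A ⊆ B → B ⊆ A → g A ≡ g B) →
      Σ (λ S → g (u ∷ S)) (subsets V) ≡
      Σ (λ C → guard (isPolymerCand? (u ∷ C)) (Σ (λ R → g (u ∷ C ++ R)) (subsets (avoiding (u ∷ C) V)))) (subsets V)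
    Σ-by-component {u} {V} I-u I-V V! u∉V g g-cong = sym (begin
      Σ (λ C → guard (P? C) (Σ (λ R → g (u ∷ C ++ R)) (subsets (avoiding (u ∷ C) V)))) (subsets V)
        ≡⟨ Σ-cong (subsets V) (λ C → cong (guard (P? C)) (restrict C)) ⟩
      Σ (λ C → guard (P? C) (Σ (λ R → guard (all? (avoids? (u ∷ C)) R) (g (u ∷ C ++ R))) (subsets V))) (subsets V)
        ≡⟨ Σ-cong (subsets V) (λ C → trans (sym (Σ-guard (P? C) _ (subsets V)))
                                           (Σ-cong (subsets V) (λ R → sym (guard-× (P? C) (all? (avoids? (u ∷ C)) R) _)))) ⟩
      Σ (λ C → Σ (ψ C) (subsets V)) (subsets V)
        ≡⟨ Σ-disjoint-pairs V V! ψ vanish ⟩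
      Σ (λ S → Σ (λ C → ψ C (S ∖ C)) (subsets S)) (subsets V)
        ≡⟨ Σ-cong-∈ (subsets V) split ⟩
      Σ (λ S → g (u ∷ S)) (subsets V) ∎)
      where
      open ≡-Reasoning
      open Difference (_≟ᵖ_ {n})
      P? = λ C → isPolymerCand? (u ∷ C)
      ψ : List (Pt n) → List (Pt n) → ℚ
      ψ C R = guard (P? C ×-dec all? (avoids? (u ∷ C)) R) (g (u ∷ C ++ R))

      restrict : ∀ C → Σ (λ R → g (u ∷ C ++ R)) (subsets (avoiding (u ∷ C) V))
                       ≡ Σ (λ R → guard (all? (avoids? (u ∷ C)) R) (g (u ∷ C ++ R))) (subsets V)
      restrict C = trans (cong (Σ _) (subsets-filter (avoids? (u ∷ C)) V)) (Σ-filter (all? (avoids? (u ∷ C))) _ (subsets V))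

      vanish : ∀ {C R y} → C ∈ subsets V → y ∈ C → y ∈ R → ψ C R ≡ 0ℚ
      vanish {C} {R} C∈ y∈C y∈R = guard-reject (P? C ×-dec all? (avoids? (u ∷ C)) R) _
        λ (_ , R⊥C) → All.lookup R⊥C y∈R (there (lose y∈C (touch-refl (All.lookup I-V (∈-subsets⇒⊆ C∈ y∈C)))))

      split : ∀ {S} → S ∈ subsets V → Σ (λ C → ψ C (S ∖ C)) (subsets S) ≡ g (u ∷ S)
      split {S} S∈ =
        trans (Σ-cong-∈ (subsets S) (λ C∈ → guard-cong (isComponent? _)
                 (λ _ → g-cong (∷⁺ʳ u (++-∖-⊆ (∈-subsets⇒⊆ C∈))) (∷⁺ʳ u ⊆-++-∖))))
              (Σ-guard-unique isComponent? (g (u ∷ S)) (subsets-Unique S!) C∈ comp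
                              (λ C′∈ comp′ → component-unique C′∈ C∈ comp′ comp))
        where
        S! : Unique S
        S! = ∈-subsets⇒Unique V! S∈
        I-S : All I S
        I-S = All.tabulate (λ y∈S → All.lookup I-V (∈-subsets⇒⊆ S∈ y∈S))
        open Component I-u I-S S! (u∉V ∘ ∈-subsets⇒⊆ S∈)
        C∈ = proj₁ (proj₂ component-exists)
        comp = proj₂ (proj₂ component-exists)

-- The cluster expansion

module Expansion (n : ℕ) where

  open Middle n
  open Linking n
  open PolymerModel compatible? Compatible-sym wC using (Ξ; compatibles; Ξ-perm; Ξ-clique)

  W : List (Pt n) → List (Pt n) → ℚ
  W Vb Sa = Σ (λ Sb → guard (all? (avoids? Sa) Sb) (wC (Sa ++ Sb))) (subsets Vb)

  Z : List (Pt n) → List (Pt n) → ℚ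
  Z Va Vb = Σ (W Vb) (subsets Va)

  polymersIn : List (Pt n) → List (Pt n) → List (List (Pt n))
  polymersIn Va Vb = filter isPolymerCand? (subsets Va ++ subsets Vb)

  Ξ′ : List (Pt n) → List (Pt n) → ℚ
  Ξ′ Va Vb = Ξ (polymersIn Va Vb)

  W-cong : ∀ Vb {S S′} → S ⊆ S′ → S′ ⊆ S → W Vb S ≡ W Vb S′
  W-cong Vb {S} {S′} S⊆S′ S′⊆S = Σ-cong (subsets Vb) λ Sb →
    trans (guard-⇔ (all? (avoids? S) Sb) (all? (avoids? S′) Sb) _ (All.map (Avoids-⊆ S′⊆S)) (All.map (Avoids-⊆ S⊆S′)))
          (cong (guard (all? (avoids? S′) Sb)) (wC-cong (++⁺ˡ Sb S⊆S′) (++⁺ˡ Sb S′⊆S)))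

  Z-sym : ∀ Va Vb → Z Va Vb ≡ Z Vb Va
  Z-sym Va Vb = trans (Σ-comm (λ Sa Sb → guard (all? (avoids? Sa) Sb) (wC (Sa ++ Sb))) (subsets Va) (subsets Vb))
    (Σ-cong (subsets Vb) λ Sb → Σ-cong (subsets Va) λ Sa →
      trans (guard-⇔ (all? (avoids? Sa) Sb) (all? (avoids? Sb) Sa) _ Avoids-sym Avoids-sym)
            (cong (guard (all? (avoids? Sb) Sa)) (wC-cong (++-comm-⊆ Sa Sb) (++-comm-⊆ Sb Sa))))
    where
    ++-comm-⊆ : ∀ (A B : List (Pt n)) → A ++ B ⊆ B ++ A
    ++-comm-⊆ A B = ↭ₚ.∈-resp-↭ (↭ₚ.++-comm A B)

  Ξ′-sym : ∀ Va Vb → Ξ′ Va Vb ≡ Ξ′ Vb Va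
  Ξ′-sym Va Vb = Ξ-perm (↭ₚ.filter-↭ isPolymerCand? (↭ₚ.++-comm (subsets Va) (subsets Vb)))

  Z-[] : Z [] [] ≡ Ξ′ [] []
  Z-[] = cong (λ w → (w ℚ.+ 0ℚ) ℚ.+ 0ℚ) wC-[]

  compatibles-polymersIn : ∀ q Va Vb → compatibles q (polymersIn Va Vb) ≡ polymersIn (avoiding q Va) (avoiding q Vb)
  compatibles-polymersIn q Va Vb = begin
    filter (compatible? q) (filter isPolymerCand? (subsets Va ++ subsets Vb))
      ≡⟨ filter-comm (compatible? q) isPolymerCand? (subsets Va ++ subsets Vb) ⟩
    filter isPolymerCand? (filter (compatible? q) (subsets Va ++ subsets Vb))
      ≡⟨ cong (filter isPolymerCand?) (LP.filter-++ (compatible? q) (subsets Va) (subsets Vb)) ⟩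
    filter isPolymerCand? (filter (compatible? q) (subsets Va) ++ filter (compatible? q) (subsets Vb))
      ≡⟨ cong (filter isPolymerCand?) (cong₂ _++_ (compatible-subsets Va) (compatible-subsets Vb)) ⟩
    polymersIn (avoiding q Va) (avoiding q Vb) ∎
    where
    open ≡-Reasoning
    compatible-subsets : ∀ V → filter (compatible? q) (subsets V) ≡ subsets (avoiding q V)
    compatible-subsets V =
      trans (filter-cong-∈ (compatible? q) (all? (avoids? q)) (subsets V) (λ _ → Compatible⇒Avoids , Avoids⇒Compatible))
            (sym (subsets-filter (avoids? q) V))

  Peel : (List (Pt n) → List (Pt n) → ℚ) → Pt n → List (Pt n) → List (Pt n) → ℚ
  Peel X u Va Vb = X Va Vb ℚ.+ Σ (λ C → guard (isPolymerCand? (u ∷ C))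
                                     (wC (u ∷ C) ℚ.* X (avoiding (u ∷ C) Va) (avoiding (u ∷ C) Vb))) (subsets Va)

  W-factor : ∀ q Vb {R} → All (Avoids q) R → W Vb (q ++ R) ≡ wC q ℚ.* W (avoiding q Vb) R
  W-factor q Vb {R} q⊥R = begin
    Σ (λ Sb → guard (all? (avoids? (q ++ R)) Sb) (wC ((q ++ R) ++ Sb))) (subsets Vb)
      ≡⟨ Σ-cong (subsets Vb) (λ Sb → trans
           (guard-⇔ (all? (avoids? (q ++ R)) Sb) (all? (avoids? q) Sb ×-dec all? (avoids? R) Sb) _
              (All-Avoids-++⁻ q R) (All-Avoids-++⁺ q R))
           (guard-× (all? (avoids? q) Sb) (all? (avoids? R) Sb) _)) ⟩
    Σ (λ Sb → guard (all? (avoids? q) Sb) (w Sb)) (subsets Vb)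
      ≡⟨ Σ-filter (all? (avoids? q)) w (subsets Vb) ⟨
    Σ w (filter (all? (avoids? q)) (subsets Vb))
      ≡⟨ cong (Σ w) (subsets-filter (avoids? q) Vb) ⟨
    Σ w (subsets (avoiding q Vb))
      ≡⟨ Σ-cong-∈ (subsets (avoiding q Vb)) split ⟩
    Σ (λ Sb → wC q ℚ.* guard (all? (avoids? R) Sb) (wC (R ++ Sb))) (subsets (avoiding q Vb))
      ≡⟨ *-distribˡ-Σ (wC q) _ (subsets (avoiding q Vb)) ⟨
    wC q ℚ.* W (avoiding q Vb) R ∎
    where
    open ≡-Reasoning
    w = λ Sb → guard (all? (avoids? R) Sb) (wC ((q ++ R) ++ Sb))
    split : ∀ {Sb} → Sb ∈ subsets (avoiding q Vb) → w Sb ≡ wC q ℚ.* guard (all? (avoids? R) Sb) (wC (R ++ Sb))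
    split {Sb} Sb∈ =
      trans (cong (guard (all? (avoids? R) Sb))
                  (trans (cong wC (LP.++-assoc q R Sb)) (wC-++ q (R ++ Sb) (Allₚ.++⁺ q⊥R (∈-subsets-avoiding Vb Sb∈)))))
            (sym (guard-*ˡ (all? (avoids? R) Sb) (wC q) _))

  module _ {I : Pt n → Set} (layer : Layer I) where

    open Layer layer

    Z-peel : ∀ {u Va} Vb → I u → All I Va → Unique (u ∷ Va) → Z (u ∷ Va) Vb ≡ Peel Z u Va Vb
    Z-peel {u} {Va} Vb I-u I-Va (u∉Va ∷ Va!) = begin
      Z (u ∷ Va) Vb
        ≡⟨ Σ-subsets-∷ (W Vb) u Va ⟩
      Z Va Vb ℚ.+ Σ (λ S → W Vb (u ∷ S)) (subsets Va)
        ≡⟨ cong (Z Va Vb ℚ.+_) (Σ-by-component layer I-u I-Va Va! (λ u∈ → All.lookup u∉Va u∈ refl) (W Vb) (W-cong Vb)) ⟩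
      Z Va Vb ℚ.+ Σ (λ C → guard (isPolymerCand? (u ∷ C)) (Σ (λ R → W Vb (u ∷ C ++ R)) (subsets (avoiding (u ∷ C) Va))))
                    (subsets Va)
        ≡⟨ cong (Z Va Vb ℚ.+_) (Σ-cong (subsets Va) λ C → cong (guard (isPolymerCand? (u ∷ C))) (factor (u ∷ C))) ⟩
      Peel Z u Va Vb ∎
      where
      open ≡-Reasoning
      factor : ∀ q → Σ (λ R → W Vb (q ++ R)) (subsets (avoiding q Va)) ≡ wC q ℚ.* Z (avoiding q Va) (avoiding q Vb)
      factor q = trans (Σ-cong-∈ (subsets (avoiding q Va)) (λ R∈ → W-factor q Vb (∈-subsets-avoiding Va R∈)))
                       (sym (*-distribˡ-Σ (wC q) (W (avoiding q Vb)) (subsets (avoiding q Va))))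

    Ξ′-peel : ∀ {u} Va Vb → I u → Ξ′ (u ∷ Va) Vb ≡ Peel Ξ′ u Va Vb
    Ξ′-peel {u} Va Vb I-u = begin
      Ξ (filter isPolymerCand? ((sa ++ sa∋u) ++ sb))
        ≡⟨ Ξ-perm (↭ₚ.filter-↭ isPolymerCand? reorder) ⟩
      Ξ (filter isPolymerCand? (sa∋u ++ sa ++ sb))
        ≡⟨ cong Ξ (LP.filter-++ isPolymerCand? sa∋u (sa ++ sb)) ⟩
      Ξ (filter isPolymerCand? sa∋u ++ polymersIn Va Vb)
        ≡⟨ Ξ-clique (filter isPolymerCand? sa∋u) (polymersIn Va Vb) clash ⟩
      Ξ′ Va Vb ℚ.+ Σ (λ q → wC q ℚ.* Ξ (compatibles q (polymersIn Va Vb))) (filter isPolymerCand? sa∋u)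
        ≡⟨ cong (Ξ′ Va Vb ℚ.+_) (trans (Σ-filter isPolymerCand? _ sa∋u) (Σ-map _ (u ∷_) sa)) ⟩
      Ξ′ Va Vb ℚ.+ Σ (λ C → guard (isPolymerCand? (u ∷ C)) (wC (u ∷ C) ℚ.* Ξ (compatibles (u ∷ C) (polymersIn Va Vb))))
                     sa
        ≡⟨ cong (Ξ′ Va Vb ℚ.+_) (Σ-cong sa λ C → cong (λ P → guard (isPolymerCand? (u ∷ C)) (wC (u ∷ C) ℚ.* Ξ P))
                                                       (compatibles-polymersIn (u ∷ C) Va Vb)) ⟩
      Peel Ξ′ u Va Vb ∎
      where
      open ≡-Reasoning
      sa = subsets Va
      sa∋u = map (u ∷_) sa
      sb = subsets Vb
      reorder : (sa ++ sa∋u) ++ sb ↭.↭ sa∋u ++ sa ++ sb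
      reorder = ↭.↭-trans (↭ₚ.++⁺ʳ sb (↭ₚ.++-comm sa sa∋u)) (↭.↭-reflexive (LP.++-assoc sa∋u sa sb))
      u∈ : ∀ {q} → q ∈ filter isPolymerCand? sa∋u → u ∈ q
      u∈ q∈ with ∈ₚ.∈-map⁻ (u ∷_) (proj₁ (∈ₚ.∈-filter⁻ isPolymerCand? {xs = sa∋u} q∈))
      ... | _ , _ , refl = here refl
      clash : ∀ {q q′} → q ∈ filter isPolymerCand? sa∋u → q′ ∈ filter isPolymerCand? sa∋u → ¬ Compatible q q′
      clash q∈ q′∈ compatible with find (touch-refl I-u)
      ... | v , v∈ , u~v , _ =
        All.lookup compatible (∂-∈⁺ v∈ (lose (u∈ q∈) u~v)) (∂-∈⁺ v∈ (lose (u∈ q′∈) u~v))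

  private
    Peel-cong : ∀ {X Y : List (Pt n) → List (Pt n) → ℚ} u Va Vb → X Va Vb ≡ Y Va Vb →
                (∀ C → let q = u ∷ C in X (avoiding q Va) (avoiding q Vb) ≡ Y (avoiding q Va) (avoiding q Vb)) →
                Peel X u Va Vb ≡ Peel Y u Va Vb
    Peel-cong u Va Vb eq eqs = cong₂ ℚ._+_ eq (Σ-cong (subsets Va) λ C →
      cong (λ x → guard (isPolymerCand? (u ∷ C)) (wC (u ∷ C) ℚ.* x)) (eqs C))

  module _ {I⁻ I⁺ : Pt n → Set} (layer⁻ : Layer I⁻) (layer⁺ : Layer I⁺) where

    private
      Z≡Ξ′-fuel : ∀ k Va Vb → length Va + length Vb ≤ k → All I⁻ Va → All I⁺ Vb → Unique Va → Unique Vb →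
                  Z Va Vb ≡ Ξ′ Va Vb
      Z≡Ξ′-fuel k [] [] _ _ _ _ _ = Z-[]
      Z≡Ξ′-fuel (suc k) (u ∷ Va) Vb (s≤s fuel) (I-u ∷ I-Va) I-Vb u∷Va!@(_ ∷ Va!) Vb! = begin
        Z (u ∷ Va) Vb    ≡⟨ Z-peel layer⁻ Vb I-u I-Va u∷Va! ⟩
        Peel Z u Va Vb   ≡⟨ Peel-cong {Z} {Ξ′} u Va Vb (Z≡Ξ′-fuel k Va Vb fuel I-Va I-Vb Va! Vb!) recurse ⟩
        Peel Ξ′ u Va Vb  ≡⟨ Ξ′-peel layer⁻ Va Vb I-u ⟨
        Ξ′ (u ∷ Va) Vb   ∎
        where
        open ≡-Reasoning
        recurse : ∀ C → let q = u ∷ C in Z (avoiding q Va) (avoiding q Vb) ≡ Ξ′ (avoiding q Va) (avoiding q Vb)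
        recurse C = Z≡Ξ′-fuel k _ _
          (ℕP.≤-trans (ℕP.+-mono-≤ (LP.length-filter (avoids? (u ∷ C)) Va) (LP.length-filter (avoids? (u ∷ C)) Vb)) fuel)
          (Allₚ.filter⁺ (avoids? (u ∷ C)) I-Va) (Allₚ.filter⁺ (avoids? (u ∷ C)) I-Vb)
          (Uniqueₚ.filter⁺ (avoids? (u ∷ C)) Va!) (Uniqueₚ.filter⁺ (avoids? (u ∷ C)) Vb!)
      Z≡Ξ′-fuel (suc k) [] (u ∷ Vb) (s≤s fuel) [] (I-u ∷ I-Vb) [] u∷Vb!@(_ ∷ Vb!) = begin
        Z [] (u ∷ Vb)    ≡⟨ Z-sym [] (u ∷ Vb) ⟩
        Z (u ∷ Vb) []    ≡⟨ Z-peel layer⁺ [] I-u I-Vb u∷Vb! ⟩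
        Peel Z u Vb []   ≡⟨ Peel-cong {Z} {Ξ′} u Vb [] (swap Vb fuel I-Vb Vb!) recurse ⟩
        Peel Ξ′ u Vb []  ≡⟨ Ξ′-peel layer⁺ Vb [] I-u ⟨
        Ξ′ (u ∷ Vb) []   ≡⟨ Ξ′-sym (u ∷ Vb) [] ⟩
        Ξ′ [] (u ∷ Vb)   ∎
        where
        open ≡-Reasoning
        swap : ∀ V → length V ≤ k → All I⁺ V → Unique V → Z V [] ≡ Ξ′ V []
        swap V fuel′ I-V V! = trans (Z-sym V []) (trans (Z≡Ξ′-fuel k [] V fuel′ [] I-V [] V!) (Ξ′-sym [] V))
        recurse : ∀ C → Z (avoiding (u ∷ C) Vb) [] ≡ Ξ′ (avoiding (u ∷ C) Vb) []
        recurse C = swap _ (ℕP.≤-trans (LP.length-filter (avoids? (u ∷ C)) Vb) fuel)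
                           (Allₚ.filter⁺ (avoids? (u ∷ C)) I-Vb) (Uniqueₚ.filter⁺ (avoids? (u ∷ C)) Vb!)

    Z≡Ξ′ : ∀ {Va Vb} → All I⁻ Va → All I⁺ Vb → Unique Va → Unique Vb → Z Va Vb ≡ Ξ′ Va Vb
    Z≡Ξ′ {Va} {Vb} = Z≡Ξ′-fuel _ Va Vb ℕP.≤-refl

  -- Ξ′ Lₙ₋₁ Lₙ₊₁ unfolds to ΞC n.
  Z≡ΞC : Z Lₙ₋₁ Lₙ₊₁ ≡ ΞC n
  Z≡ΞC = Z≡Ξ′ layerₙ₋₁ layerₙ₊₁ (All.tabulate ∈Lₙ₋₁⁻) (All.tabulate ∈Lₙ₊₁⁻) Lₙ₋₁-unique Lₙ₊₁-unique

-- Antichains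

module Antichains (n : ℕ) where

  open Middle n
  open Expansion n

  FreeOf : List (Pt n) → Pt n → Set
  FreeOf S v = ¬ Any (Comparable v) S

  freeOf? : ∀ S v → Dec (FreeOf S v)
  freeOf? S v = ¬? (any? (comparable? v) S)

  module _ {Tm Tn Tp} (Tm∈ : Tm ∈ subsets Lₙ₋₁) (Tn∈ : Tn ∈ subsets Lₙ)
                      (Tp∈ : Tp ∈ subsets Lₙ₊₁) where

    private
      Tm⊆ : ∀ {a} → a ∈ Tm → InLₙ₋₁ a
      Tm⊆ = ∈Lₙ₋₁⁻ ∘ ∈-subsets⇒⊆ Tm∈
      Tp⊆ : ∀ {b} → b ∈ Tp → InLₙ₊₁ b
      Tp⊆ = ∈Lₙ₊₁⁻ ∘ ∈-subsets⇒⊆ Tp∈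

    IsAntichain⇒ : IsAntichain (Tm ++ Tn ++ Tp) → All (Avoids Tm) Tp × All (FreeOf (Tm ++ Tp)) Tn
    IsAntichain⇒ antichain = All.tabulate Tp-avoids , All.tabulate Tn-free
      where
      m×np : All (λ a → All (λ c → ¬ Comparable a c) (Tn ++ Tp)) Tm
      m×np = proj₂ (proj₂ (AllPairs-++⁻ Tm antichain))
      n×p : All (λ v → All (λ b → ¬ Comparable v b) Tp) Tn
      n×p = proj₂ (proj₂ (AllPairs-++⁻ Tn (proj₁ (proj₂ (AllPairs-++⁻ Tm antichain)))))
      Tp-avoids : ∀ {b} → b ∈ Tp → Avoids Tm b
      Tp-avoids b∈ touch = let a , a∈ , a~b = find touch in
        All.lookup (All.lookup m×np a∈) (∈ₚ.∈-++⁺ʳ Tn b∈) (Touch⇒Comparable (Tm⊆ a∈) (Tp⊆ b∈) a~b)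
      Tn-free : ∀ {v} → v ∈ Tn → FreeOf (Tm ++ Tp) v
      Tn-free v∈ comparable with find comparable
      ... | x , x∈ , v~x with ∈ₚ.∈-++⁻ Tm x∈
      ...   | inj₁ x∈Tm = All.lookup (All.lookup m×np x∈Tm) (∈ₚ.∈-++⁺ˡ v∈) (Sum.swap v~x)
      ...   | inj₂ x∈Tp = All.lookup (All.lookup n×p v∈) x∈Tp v~x

    IsAntichain⇐ : All (Avoids Tm) Tp × All (FreeOf (Tm ++ Tp)) Tn → IsAntichain (Tm ++ Tn ++ Tp)
    IsAntichain⇐ (Tm⊥Tp , Tn-free) =
      AllPairsₚ.++⁺ (level-antichain Lₙ₋₁-unique (cong ℕ.pred ∘ ∈Lₙ₋₁⁻) Tm∈)
        (AllPairsₚ.++⁺ (level-antichain Lₙ-unique ∈Lₙ⁻ Tn∈) (level-antichain Lₙ₊₁-unique ∈Lₙ₊₁⁻ Tp∈)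
                       (All.tabulate λ v∈ → All.tabulate (n×p v∈)))
        (All.tabulate λ a∈ → All.tabulate (m×np a∈))
      where
      level-antichain : ∀ {L T r} → Unique L → (∀ {v} → v ∈ L → rank v ≡ r) → T ∈ subsets L → IsAntichain T
      level-antichain L! rank-L T∈ =
        sameRank⇒IsAntichain (∈-subsets⇒Unique L! T∈) (All.tabulate (rank-L ∘ ∈-subsets⇒⊆ T∈))
      n×p : ∀ {v b} → v ∈ Tn → b ∈ Tp → ¬ Comparable v b
      n×p v∈ b∈ v~b = All.lookup Tn-free v∈ (Anyₚ.++⁺ʳ Tm (lose b∈ v~b))
      m×np : ∀ {a c} → a ∈ Tm → c ∈ Tn ++ Tp → ¬ Comparable a c
      m×np a∈ c∈ a~c with ∈ₚ.∈-++⁻ Tn c∈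
      ... | inj₁ c∈Tn = All.lookup Tn-free c∈Tn (Anyₚ.++⁺ˡ (lose a∈ (Sum.swap a~c)))
      ... | inj₂ c∈Tp = All.lookup Tm⊥Tp c∈Tp (lose a∈ (Comparable⇒Touch (Tm⊆ a∈) (Tp⊆ c∈Tp) a~c))

  count-free : ∀ S → Σ (λ Tn → guard (all? (freeOf? S) Tn) 1ℚ) (subsets Lₙ) ≡ fromℕ (2 ^ ℓ n) ℚ.* wC S
  count-free S = begin
    Σ (λ Tn → guard (all? (freeOf? S) Tn) 1ℚ) (subsets Lₙ)
      ≡⟨ Σ-filter (all? (freeOf? S)) (λ _ → 1ℚ) (subsets Lₙ) ⟨
    Σ (λ _ → 1ℚ) (filter (all? (freeOf? S)) (subsets Lₙ))
      ≡⟨ cong (Σ (λ _ → 1ℚ)) (subsets-filter (freeOf? S) Lₙ) ⟨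
    Σ (λ _ → 1ℚ) (subsets (filter (freeOf? S) Lₙ))
      ≡⟨ Σ-one (subsets (filter (freeOf? S) Lₙ)) ⟩
    fromℕ (length (subsets (filter (freeOf? S) Lₙ)))
      ≡⟨ cong fromℕ (length-subsets (filter (freeOf? S) Lₙ)) ⟩
    fromℕ (2 ^ length (filter (freeOf? S) Lₙ))
      ≡⟨ 2^-split {b = length (∂ S)} (length-filter-∁ (λ v → any? (comparable? v) S) Lₙ) ⟩
    fromℕ (2 ^ ℓ n) ℚ.* wC S ∎
    where open ≡-Reasoning

  private
    indicator : List (Pt n) → List (Pt n) → List (Pt n) → ℚ
    indicator Tm Tn Tp = guard (all? (avoids? Tm) Tp) (guard (all? (freeOf? (Tm ++ Tp)) Tn) 1ℚ)

    antichain-indicator : ∀ {Tm Tn Tp} → Tm ∈ subsets Lₙ₋₁ → Tn ∈ subsets Lₙ → Tp ∈ subsets Lₙ₊₁ →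
                          guard (isAntichain? (Tm ++ Tn ++ Tp)) 1ℚ ≡ indicator Tm Tn Tp
    antichain-indicator {Tm} {Tn} {Tp} Tm∈ Tn∈ Tp∈ =
      trans (guard-⇔ (isAntichain? (Tm ++ Tn ++ Tp)) (all? (avoids? Tm) Tp ×-dec all? (freeOf? (Tm ++ Tp)) Tn) 1ℚ
                     (IsAntichain⇒ Tm∈ Tn∈ Tp∈) (IsAntichain⇐ Tm∈ Tn∈ Tp∈))
            (guard-× (all? (avoids? Tm) Tp) (all? (freeOf? (Tm ++ Tp)) Tn) 1ℚ)

    Σ-indicator : ∀ Tm Tp → Σ (λ Tn → indicator Tm Tn Tp) (subsets Lₙ)
                            ≡ fromℕ (2 ^ ℓ n) ℚ.* guard (all? (avoids? Tm) Tp) (wC (Tm ++ Tp))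
    Σ-indicator Tm Tp = trans (Σ-guard (all? (avoids? Tm) Tp) _ (subsets Lₙ))
      (trans (cong (guard (all? (avoids? Tm) Tp)) (count-free (Tm ++ Tp)))
             (sym (guard-*ˡ (all? (avoids? Tm) Tp) (fromℕ (2 ^ ℓ n)) (wC (Tm ++ Tp)))))

  α≡2^ℓ*Z : fromℕ (α-mid n) ≡ fromℕ (2 ^ ℓ n) ℚ.* Z Lₙ₋₁ Lₙ₊₁
  α≡2^ℓ*Z = begin
    fromℕ (length (filter isAntichain? (subsets (Lₙ₋₁ ++ Lₙ ++ Lₙ₊₁))))
      ≡⟨ Σ-one (filter isAntichain? (subsets (Lₙ₋₁ ++ Lₙ ++ Lₙ₊₁))) ⟨
    Σ (λ _ → 1ℚ) (filter isAntichain? (subsets (Lₙ₋₁ ++ Lₙ ++ Lₙ₊₁)))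
      ≡⟨ Σ-filter isAntichain? (λ _ → 1ℚ) (subsets (Lₙ₋₁ ++ Lₙ ++ Lₙ₊₁)) ⟩
    Σ antichain (subsets (Lₙ₋₁ ++ Lₙ ++ Lₙ₊₁))
      ≡⟨ Σ-subsets-++ antichain Lₙ₋₁ (Lₙ ++ Lₙ₊₁) ⟩
    Σ (λ Tm → Σ (λ T → antichain (Tm ++ T)) (subsets (Lₙ ++ Lₙ₊₁))) (subsets Lₙ₋₁)
      ≡⟨ Σ-cong (subsets Lₙ₋₁) (λ Tm → Σ-subsets-++ (λ T → antichain (Tm ++ T)) Lₙ Lₙ₊₁) ⟩
    Σ (λ Tm → Σ (λ Tn → Σ (λ Tp → antichain (Tm ++ Tn ++ Tp)) (subsets Lₙ₊₁)) (subsets Lₙ)) (subsets Lₙ₋₁)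
      ≡⟨ Σ-cong-∈ (subsets Lₙ₋₁) (λ Tm∈ → Σ-cong-∈ (subsets Lₙ) (λ Tn∈ →
           Σ-cong-∈ (subsets Lₙ₊₁) (antichain-indicator Tm∈ Tn∈))) ⟩
    Σ (λ Tm → Σ (λ Tn → Σ (indicator Tm Tn) (subsets Lₙ₊₁)) (subsets Lₙ)) (subsets Lₙ₋₁)
      ≡⟨ Σ-cong (subsets Lₙ₋₁) (λ Tm → trans (Σ-comm (indicator Tm) (subsets Lₙ) (subsets Lₙ₊₁))
                                              (Σ-cong (subsets Lₙ₊₁) (Σ-indicator Tm))) ⟩
    Σ (λ Tm → Σ (λ Tp → fromℕ (2 ^ ℓ n) ℚ.* guard (all? (avoids? Tm) Tp) (wC (Tm ++ Tp))) (subsets Lₙ₊₁))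
      (subsets Lₙ₋₁)
      ≡⟨ Σ-cong (subsets Lₙ₋₁) (λ Tm → *-distribˡ-Σ (fromℕ (2 ^ ℓ n)) _ (subsets Lₙ₊₁)) ⟨
    Σ (λ Tm → fromℕ (2 ^ ℓ n) ℚ.* W Lₙ₊₁ Tm) (subsets Lₙ₋₁)
      ≡⟨ *-distribˡ-Σ (fromℕ (2 ^ ℓ n)) (W Lₙ₊₁) (subsets Lₙ₋₁) ⟨
    fromℕ (2 ^ ℓ n) ℚ.* Z Lₙ₋₁ Lₙ₊₁ ∎
    where
    open ≡-Reasoning
    antichain : List (Pt n) → ℚ
    antichain T = guard (isAntichain? T) 1ℚ

open import Data.Integer using (+_)
open import Data.Rational using (_*_)

lemma6p1 : (n : ℕ) → ((+ (2 ^ ℓ n)) / 1) * ΞC n ≡ (+ α-mid n) / 1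
lemma6p1 n = begin
  fromℕ (2 ^ ℓ n) * ΞC n       ≡⟨ cong (fromℕ (2 ^ ℓ n) *_) Z≡ΞC ⟨
  fromℕ (2 ^ ℓ n) * Z Lₙ₋₁ Lₙ₊₁  ≡⟨ α≡2^ℓ*Z ⟨
  fromℕ (α-mid n)              ∎
  where
  open ≡-Reasoning
  open Middle n
  open Expansion n
  open Antichains n
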